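{- Let $k\geq 2$ be an integer. For integers $n\geq 0$ and $0\leq m\leq n$, let $g_k(n,m)$ denote the number of $k$-noncrossing matchings on the vertex set $[2n]=\{1,\dots,2n\}$ having exactly $m$ $1$-arcs. Then for all $n,m\geq 0$, \[ (m+1)\,g_k(n+1,m+1)=(m+1)\,g_k(n,m+1)+(2n+1-m)\,g_k(n,m), \] and the generating function ${\bf G}_k(x,y)=\sum_{n\geq 0}\sum_{m=0}^{n}g_k(n,m)x^ny^m$ satisfies \[ {\bf G}_k(x,y)=\frac{1}{x+1-yx}\,{\bf F}_k\!\left(\frac{x}{(x+1-yx)^2}\right), \] where ${\bf F}_k(z)=\sum_{n\geq 0}f_k(2n,0)z^n$.
   Context: A diagram on $[n]$ is a graph on vertex set $[n]=\{1,\dots,n\}$ with all vertex degrees $\leq 1$; its edges are written as arcs $(i,j)$ with $i<j$. A vertex of degree $0$ is isolated. A matching is a diagram without isolated vertices. A $k$-crossing is a set of arcs $(i_1,j_1),\dots,(i_k,j_k)$ with $i_1<i_2<\dots<i_k<j_1<j_2<\dots<j_k$; a diagram is $k$-noncrossing if it contains no $k$-crossing. A $1$-arc is an arc of the form $(i,i+1)$. $f_k(2n,0)$ denotes the number of $k$-noncrossing matchings on $[2n]$ (with $f_k(0,0)=1$), and $g_k(n,m)=0$ when $m>n$ or arguments are out of range. -}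

module Defs where

open import Data.Nat using (ℕ; zero; suc; _+_; _*_; _∸_; _<_; _≤_)
import Data.Nat as ℕ
open import Data.Integer using (ℤ; +_; -_) renaming (_+_ to _+ℤ_; _*_ to _*ℤ_)
open import Data.Fin using (Fin; toℕ)
import Data.Fin as Fin
open import Data.Fin.Properties using (all?; any?)
open import Data.Vec using (Vec; []; _∷_; lookup)
open import Data.List using (List; []; _∷_; map; concatMap; filter; length; allFin)
open import Data.List.Relation.Unary.Any using (Any; satisfied)
import Data.List.Relation.Unary.Any as Any
open import Data.List.Membership.Propositional using (_∈_; lose)
open import Data.List.Membership.Propositional.Properties using (∈-map⁺; ∈-concatMap⁺; ∈-allFin)
open import Data.Empty using (⊥-elim)
open import Data.Product using (Σ; ∃; _×_; _,_; proj₁; proj₂)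
open import Relation.Nullary using (Dec; yes; no; ¬_; map′)
open import Relation.Nullary.Decidable using (_×-dec_; ¬?)
open import Relation.Binary.PropositionalEquality using (_≡_; _≢_; refl)

-- Diagrams on [N] are encoded via vertex set Fin N (vertex i ↔ toℕ i + 1).
-- A matching on [N] is encoded by its partner function p : Fin N → Fin N,
-- a fixed-point-free involution; arcs are the pairs {i , p i}.

IsMatching : (N : ℕ) → (Fin N → Fin N) → Set
IsMatching N p = (∀ i → p (p i) ≡ i) × (∀ i → p i ≢ i)

-- c is the vector of left endpoints (i_1,…,i_k) of a k-crossing of p:
-- arcs (i_t , p i_t) with i_1 < … < i_k < p i_1 < … < p i_k.
IsCrossingAt : (N k : ℕ) → (Fin N → Fin N) → Vec (Fin N) k → Set
IsCrossingAt N k p c =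
  (∀ s t → s Fin.< t → toℕ (lookup c s) < toℕ (lookup c t)) ×
  (∀ s t → s Fin.< t → toℕ (p (lookup c s)) < toℕ (p (lookup c t))) ×
  (∀ s t → toℕ (lookup c s) < toℕ (p (lookup c t)))

HasKCrossing : (N k : ℕ) → (Fin N → Fin N) → Set
HasKCrossing N k p = ∃ λ (c : Vec (Fin N) k) → IsCrossingAt N k p c

KNoncrossing : (N k : ℕ) → (Fin N → Fin N) → Set
KNoncrossing N k p = ¬ HasKCrossing N k p

IsOneArcStart : (N : ℕ) → (Fin N → Fin N) → Fin N → Set
IsOneArcStart N p i = toℕ (p i) ≡ suc (toℕ i)

numOneArcs : (N : ℕ) → (Fin N → Fin N) → ℕ
numOneArcs N p = length (filter (λ i → toℕ (p i) ℕ.≟ suc (toℕ i)) (allFin N))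

allVecs : (N k : ℕ) → List (Vec (Fin N) k)
allVecs N zero = [] ∷ []
allVecs N (suc k) = concatMap (λ v → map (_∷ v) (allFin N)) (allVecs N k)

∈-allVecs : ∀ {N k} (v : Vec (Fin N) k) → v ∈ allVecs N k
∈-allVecs [] = Any.here refl
∈-allVecs {N} (x ∷ v) =
  ∈-concatMap⁺ (λ w → map (_∷ w) (allFin N)) (lose (∈-allVecs v) (∈-map⁺ (_∷ v) (∈-allFin x)))

private
  <? : ∀ a b → Dec (a < b)
  <? a b = a ℕ.<? b

  finLt? : ∀ {k} (s t : Fin k) → Dec (s Fin.< t)
  finLt? s t = toℕ s ℕ.<? toℕ t

  imp? : ∀ {A B : Set} → Dec A → Dec B → Dec (A → B)
  imp? _ (yes b) = yes (λ _ → b)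
  imp? (no ¬a) _ = yes (λ a → ⊥-elim (¬a a))
  imp? (yes a) (no ¬b) = no (λ f → ¬b (f a))

isCrossingAt? : ∀ N k p c → Dec (IsCrossingAt N k p c)
isCrossingAt? N k p c =
  all? (λ s → all? (λ t → imp? (finLt? s t) (<? _ _))) ×-dec
  (all? (λ s → all? (λ t → imp? (finLt? s t) (<? _ _))) ×-dec
   all? (λ s → all? (λ t → <? _ _)))

hasKCrossing? : ∀ N k p → Dec (HasKCrossing N k p)
hasKCrossing? N k p =
  map′ satisfied (λ { (c , h) → lose (∈-allVecs c) h })
       (Any.any? (isCrossingAt? N k p) (allVecs N k))

isMatching? : ∀ N p → Dec (IsMatching N p)
isMatching? N p = all? (λ i → p (p i) Fin.≟ i) ×-dec all? (λ i → ¬? (p i Fin.≟ i))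

-- Counting.  Every partner function Fin N → Fin N is tabulated exactly once
-- as a vector v : Vec (Fin N) N (via lookup v), so counting vectors counts
-- matchings.

-- f_k(2n,0): number of k-noncrossing matchings on [2n]
fk : (k n : ℕ) → ℕ
fk k n = length (filter (λ v → isMatching? (2 * n) (lookup v) ×-dec
                               ¬? (hasKCrossing? (2 * n) k (lookup v)))
                        (allVecs (2 * n) (2 * n)))

gk : (k n m : ℕ) → ℕ
gk k n m = length (filter (λ v → isMatching? (2 * n) (lookup v) ×-dec
                                 (¬? (hasKCrossing? (2 * n) k (lookup v)) ×-dec
                                  (numOneArcs (2 * n) (lookup v) ℕ.≟ m)))
                          (allVecs (2 * n) (2 * n)))

-- Formal power series over ℤ.
-- Series1 : univariate, coefficient of z^n.
-- Series2 : bivariate, a n m = coefficient of x^n y^m.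

Series1 : Set
Series1 = ℕ → ℤ

Series2 : Set
Series2 = ℕ → ℕ → ℤ

_≈₂_ : Series2 → Series2 → Set
a ≈₂ b = ∀ n m → a n m ≡ b n m

sumTo : ℕ → (ℕ → ℤ) → ℤ
sumTo zero f = f zero
sumTo (suc n) f = sumTo n f +ℤ f (suc n)

_*₂_ : Series2 → Series2 → Series2
(a *₂ b) n m = sumTo n (λ i → sumTo m (λ l → a i l *ℤ b (n ∸ i) (m ∸ l)))

one₂ : Series2
one₂ zero zero = + 1
one₂ _ _ = + 0

X₂ : Series2
X₂ 1 zero = + 1
X₂ _ _ = + 0

D₂ : Series2
D₂ zero zero = + 1
D₂ 1 zero = + 1
D₂ 1 1 = - (+ 1)
D₂ _ _ = + 0

pow₂ : Series2 → ℕ → Series2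
pow₂ u zero = one₂
pow₂ u (suc j) = u *₂ pow₂ u j

-- Composition F(u) = Σ_j F_j u^j, for u with no terms of x-degree 0
-- (then u^j only has terms of x-degree ≥ j, so the coefficient of x^n y^m
-- is the finite sum over j ≤ n).
compose : Series1 → Series2 → Series2
compose F u n m = sumTo n (λ j → F j *ℤ pow₂ u j n m)

Fk : ℕ → Series1
Fk k n = + fk k n

-- G_k(x,y) = Σ_n Σ_{m ≤ n} g_k(n,m) x^n y^m   (g_k(n,m) = 0 for m > n)
Gk : ℕ → Series2
Gk k n m = + gk k n m

module Submission where

-- Marking one of the m+1 1-arcs of a matching on [2n+2] and deleting it leaves a matching on
-- [2n] and the gap j ≤ 2n where the arc sat.  Inserting a 1-arc at a gap adds one 1-arc,
-- destroys the 1-arc it splits (if any) and neither creates nor destroys a k-crossing for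
-- k ≥ 2.  Hence a matching on [2n] with m+1 1-arcs has m+1 gaps giving m+1 1-arcs, and one
-- with m 1-arcs has 2n+1-m such gaps; double counting the marked matchings is the recurrence.
--
-- For the generating function, (x+1-yx) w = 1 forces w = Σ (-1)^(a+b) C(a,b) x^a y^b, and
-- w (x w²)^j = x^j (x+1-yx)^-(2j+1) has coefficient (-1)^(a+b) C(2j+a,a) C(a,b) at x^(a+j) y^b.
-- By absorption identities the resulting closed form of w F(x w²) obeys the same recurrence as
-- g_k; at y = 1 every power of x+1-yx is 1, so both have row sums f_k(2n,0); and their first
-- rows agree.  The recurrence then fixes the coefficients at y^(m+1) of each next row and the
-- row sum the one at y^0.


module Counting where

  open import Data.Nat
  open import Data.Nat.Properties
  open import Algebra.Properties.CommutativeSemigroup +-commutativeSemigroup using () renaming (interchange to +-interchange)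
  open import Data.List using (List; []; _∷_; map; filter; length; cartesianProduct; _++_)
  open import Data.List.Properties using (length-map)
  open import Data.List.Membership.Propositional using (_∈_)
  open import Data.List.Relation.Unary.Any using (here; there)
  open import Data.List.Membership.Propositional.Properties using (∈-map⁻; ∈-filter⁺; ∈-filter⁻)
  open import Data.List.Relation.Unary.All as All using (All; []; _∷_)
  import Data.List.Relation.Unary.All.Properties as All
  open import Data.List.Relation.Unary.AllPairs using ([]; _∷_)
  open import Data.List.Relation.Unary.Unique.Propositional using (Unique)
  import Data.List.Relation.Unary.Unique.Propositional.Properties as Unique
  open import Data.Product using (_×_; _,_; proj₁; proj₂)
  open import Relation.Nullary using (Dec; yes; no; ¬_)
  open import Relation.Unary using (Decidable)
  open import Relation.Binary.Definitions using (DecidableEquality)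
  open import Relation.Binary.PropositionalEquality
  open import Data.Empty using (⊥-elim)

  𝟙 : ∀ {p} {P : Set p} → Dec P → ℕ
  𝟙 (yes _) = 1
  𝟙 (no _) = 0

  𝟙-yes : ∀ {P : Set} (d : Dec P) → P → 𝟙 d ≡ 1
  𝟙-yes (yes _) _ = refl
  𝟙-yes (no ¬p) p = ⊥-elim (¬p p)

  𝟙-no : ∀ {P : Set} (d : Dec P) → ¬ P → 𝟙 d ≡ 0
  𝟙-no (yes p) ¬p = ⊥-elim (¬p p)
  𝟙-no (no _) _ = refl

  𝟙-cong : ∀ {P Q : Set} (a : Dec P) (b : Dec Q) → (P → Q) → (Q → P) → 𝟙 a ≡ 𝟙 b
  𝟙-cong (yes _) (yes _) _ _ = refl
  𝟙-cong (no _) (no _) _ _ = refl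
  𝟙-cong (yes p) (no ¬q) f _ = ⊥-elim (¬q (f p))
  𝟙-cong (no ¬p) (yes q) _ g = ⊥-elim (¬p (g q))

  𝟙-× : ∀ {p q} {P : Set p} {Q : Set q} (a : Dec P) (b : Dec Q) (c : Dec (P × Q)) → 𝟙 a * 𝟙 b ≡ 𝟙 c
  𝟙-× (yes p) (yes q) (yes _) = refl
  𝟙-× (yes p) (yes q) (no ¬c) = ⊥-elim (¬c (p , q))
  𝟙-× (no ¬p) _ (yes c) = ⊥-elim (¬p (proj₁ c))
  𝟙-× (yes _) (no ¬q) (yes c) = ⊥-elim (¬q (proj₂ c))
  𝟙-× (no _) _ (no _) = refl
  𝟙-× (yes _) (no _) (no _) = refl

  module _ {A : Set} where

    count : {P : A → Set} → Decidable P → List A → ℕ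
    count P? xs = length (filter P? xs)

    count-∷ : ∀ {P : A → Set} (P? : Decidable P) x xs → count P? (x ∷ xs) ≡ 𝟙 (P? x) + count P? xs
    count-∷ P? x xs with P? x
    ... | yes _ = refl
    ... | no _ = refl

    count-++ : ∀ {P : A → Set} (P? : Decidable P) xs ys → count P? (xs ++ ys) ≡ count P? xs + count P? ys
    count-++ P? [] ys = refl
    count-++ P? (x ∷ xs) ys rewrite count-∷ P? x (xs ++ ys) | count-∷ P? x xs | count-++ P? xs ys =
      sym (+-assoc (𝟙 (P? x)) _ _)

    count-cong : ∀ {P Q : A → Set} (P? : Decidable P) (Q? : Decidable Q) xs →
      (∀ x → P x → Q x) → (∀ x → Q x → P x) → count P? xs ≡ count Q? xs
    count-cong P? Q? [] _ _ = refl
    count-cong P? Q? (x ∷ xs) f g rewrite count-∷ P? x xs | count-∷ Q? x xs =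
      cong₂ _+_ (𝟙-cong (P? x) (Q? x) (f x) (g x)) (count-cong P? Q? xs f g)

    count-none : ∀ {P : A → Set} (P? : Decidable P) xs → (∀ x → ¬ P x) → count P? xs ≡ 0
    count-none P? [] _ = refl
    count-none P? (x ∷ xs) h rewrite count-∷ P? x xs | 𝟙-no (P? x) (h x) = count-none P? xs h

    sumOver : List A → (A → ℕ) → ℕ
    sumOver [] f = 0
    sumOver (x ∷ xs) f = f x + sumOver xs f

    sumOver-cong : ∀ xs (f g : A → ℕ) → (∀ x → f x ≡ g x) → sumOver xs f ≡ sumOver xs g
    sumOver-cong [] f g h = refl
    sumOver-cong (x ∷ xs) f g h = cong₂ _+_ (h x) (sumOver-cong xs f g h)

    sumOver-distrib : ∀ xs (f g : A → ℕ) → sumOver xs (λ x → f x + g x) ≡ sumOver xs f + sumOver xs g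
    sumOver-distrib [] f g = refl
    sumOver-distrib (x ∷ xs) f g rewrite sumOver-distrib xs f g = +-interchange (f x) (g x) (sumOver xs f) (sumOver xs g)

    sumOver-*ˡ : ∀ xs (f : A → ℕ) c → sumOver xs (λ x → c * f x) ≡ c * sumOver xs f
    sumOver-*ˡ [] f c = sym (*-zeroʳ c)
    sumOver-*ˡ (x ∷ xs) f c rewrite sumOver-*ˡ xs f c = sym (*-distribˡ-+ c (f x) (sumOver xs f))

    sumOver-𝟙 : ∀ {P : A → Set} (P? : Decidable P) xs → sumOver xs (λ x → 𝟙 (P? x)) ≡ count P? xs
    sumOver-𝟙 P? [] = refl
    sumOver-𝟙 P? (x ∷ xs) rewrite count-∷ P? x xs = cong (𝟙 (P? x) +_) (sumOver-𝟙 P? xs)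

  count-cartesianProduct : ∀ {A B : Set} {P : A → Set} {Q : A → B → Set}
    (P? : Decidable P) (Q? : ∀ a → Decidable (Q a))
    (R? : Decidable (λ (ab : A × B) → P (proj₁ ab) × Q (proj₁ ab) (proj₂ ab))) xs ys →
    count R? (cartesianProduct xs ys) ≡ sumOver xs (λ a → 𝟙 (P? a) * count (Q? a) ys)
  count-cartesianProduct P? Q? R? [] ys = refl
  count-cartesianProduct P? Q? R? (x ∷ xs) ys =
    trans (count-++ R? (map (x ,_) ys) (cartesianProduct xs ys))
          (cong₂ _+_ (row ys) (count-cartesianProduct P? Q? R? xs ys))
    where
    row : ∀ ys → count R? (map (x ,_) ys) ≡ 𝟙 (P? x) * count (Q? x) ys
    row [] = sym (*-zeroʳ (𝟙 (P? x)))
    row (y ∷ ys) rewrite count-∷ R? (x , y) (map (x ,_) ys) | count-∷ (Q? x) y ys | row ys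
      | *-distribˡ-+ (𝟙 (P? x)) (𝟙 (Q? x y)) (count (Q? x) ys) | 𝟙-× (P? x) (Q? x y) (R? (x , y)) = refl

  module _ {B : Set} (_≟_ : DecidableEquality B) where

    private
      remove : B → List B → List B
      remove b [] = []
      remove b (x ∷ xs) with b ≟ x
      ... | yes _ = xs
      ... | no _ = x ∷ remove b xs

      length-remove : ∀ b xs → b ∈ xs → suc (length (remove b xs)) ≡ length xs
      length-remove b (x ∷ xs) b∈ with b ≟ x
      ... | yes _ = refl
      length-remove b (x ∷ xs) (here refl) | no b≢x = ⊥-elim (b≢x refl)
      length-remove b (x ∷ xs) (there b∈) | no _ = cong suc (length-remove b xs b∈)

      ∈-remove : ∀ b y xs → y ∈ xs → b ≢ y → y ∈ remove b xs
      ∈-remove b y (x ∷ xs) y∈ b≢y with b ≟ x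
      ∈-remove b y (x ∷ xs) (here refl) b≢y | yes refl = ⊥-elim (b≢y refl)
      ∈-remove b y (x ∷ xs) (there y∈) b≢y | yes refl = y∈
      ∈-remove b y (x ∷ xs) (here refl) b≢y | no _ = here refl
      ∈-remove b y (x ∷ xs) (there y∈) b≢y | no _ = there (∈-remove b y xs y∈ b≢y)

    length-mono-Unique : ∀ (L M : List B) → Unique L → (∀ {b} → b ∈ L → b ∈ M) → length L ≤ length M
    length-mono-Unique [] M _ _ = z≤n
    length-mono-Unique (b ∷ L) M (b∉L ∷ u) L⊆M =
      subst (suc (length L) ≤_) (length-remove b M (L⊆M (here refl)))
        (s≤s (length-mono-Unique L (remove b M) u
          (λ y∈L → ∈-remove b _ M (L⊆M (there y∈L)) (All.lookup b∉L y∈L))))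

  module _ {A B : Set} {P : A → Set} {f : A → B} where

    Unique-map-injectiveOn : (∀ {a a'} → P a → P a' → f a ≡ f a' → a ≡ a') →
      ∀ {xs} → All P xs → Unique xs → Unique (map f xs)
    Unique-map-injectiveOn inj [] [] = []
    Unique-map-injectiveOn inj (pa ∷ ps) (a∉ ∷ u) =
      All.map⁺ (All.zipWith (λ (a≢a' , pa') e → a≢a' (inj pa pa' e)) (a∉ , ps))
      ∷ Unique-map-injectiveOn inj ps u

  count-≤-injection : ∀ {A B : Set} (_≟_ : DecidableEquality B) {P : A → Set} {Q : B → Set}
    (P? : Decidable P) (Q? : Decidable Q) (xs : List A) (ys : List B) → Unique xs →
    (∀ b → Q b → b ∈ ys) → (f : A → B) → (∀ {a} → P a → Q (f a)) →
    (∀ {a a'} → P a → P a' → f a ≡ f a' → a ≡ a') → count P? xs ≤ count Q? ys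
  count-≤-injection _≟_ P? Q? xs ys xs! ys-complete f f-pres f-inj =
    subst (_≤ count Q? ys) (length-map f (filter P? xs))
      (length-mono-Unique _≟_ (map f (filter P? xs)) (filter Q? ys)
        (Unique-map-injectiveOn f-inj (All.all-filter P? xs) (Unique.filter⁺ P? xs!))
        image⊆)
    where
    image⊆ : ∀ {b} → b ∈ map f (filter P? xs) → b ∈ filter Q? ys
    image⊆ b∈ with ∈-map⁻ f b∈
    ... | a , a∈ , refl = let qfa = f-pres (proj₂ (∈-filter⁻ P? {xs = xs} a∈)) in ∈-filter⁺ Q? {xs = ys} (ys-complete _ qfa) qfa


module Encoding where

  open import Data.Nat
  open import Data.Nat.Properties
  open import Algebra.Properties.CommutativeSemigroup +-commutativeSemigroup using () renaming (interchange to +-interchange)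
  open import Data.Fin as F using (Fin; toℕ; fromℕ<)
  open import Data.Fin.Properties using (toℕ-injective; toℕ<n; toℕ-fromℕ<)
  open import Data.Vec as V using (Vec; []; _∷_; lookup; tabulate)
  open import Data.Vec.Properties using (lookup∘tabulate)
  import Data.List as L
  open import Data.List using (List; concatMap; cartesianProductWith)
  open import Data.List.Properties using (length-filter; length-tabulate)
  open import Data.List.Relation.Unary.Unique.Propositional using (Unique)
  open import Data.List.Relation.Unary.Unique.Propositional.Properties using (cartesianProductWith⁺; allFin⁺)
  open import Data.List.Relation.Unary.AllPairs using ([]; _∷_)
  open import Data.List.Relation.Unary.All using ([])
  open import Data.Product using (Σ; _×_; _,_)
  open import Relation.Nullary using (yes; no)
  open import Relation.Unary using (Decidable)
  open import Relation.Binary.PropositionalEquality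
  open import Data.Empty using (⊥-elim)
  open import Defs
  open Counting

  -- A partner function is handled through the values toℕ (lookup v i) as a map ℕ → ℕ, whose
  -- values at x ≥ N are junk; every statement about it is restricted to x < N.
  at : ∀ {N M} → Vec (Fin N) M → ℕ → ℕ
  at [] x = 0
  at (a ∷ v) zero = toℕ a
  at (a ∷ v) (suc x) = at v x

  at-lookup : ∀ {N M} (v : Vec (Fin N) M) (i : Fin M) → at v (toℕ i) ≡ toℕ (lookup v i)
  at-lookup (a ∷ v) F.zero = refl
  at-lookup (a ∷ v) (F.suc i) = at-lookup v i

  at-< : ∀ {N M} (v : Vec (Fin N) M) x → x < M → at v x < N
  at-< (a ∷ v) zero _ = toℕ<n a
  at-< (a ∷ v) (suc x) (s≤s x<M) = at-< v x x<M

  at-injective : ∀ {N M} (v w : Vec (Fin N) M) → (∀ x → x < M → at v x ≡ at w x) → v ≡ w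
  at-injective [] [] _ = refl
  at-injective (a ∷ v) (b ∷ w) h =
    cong₂ _∷_ (toℕ-injective (h 0 z<s)) (at-injective v w (λ x x<M → h (suc x) (s≤s x<M)))

  toFinOr : ∀ {N} → Fin N → ℕ → Fin N
  toFinOr {N} d x with x <? N
  ... | yes x<N = fromℕ< x<N
  ... | no _ = d

  toℕ-toFinOr : ∀ {N} (d : Fin N) x → x < N → toℕ (toFinOr d x) ≡ x
  toℕ-toFinOr {N} d x x<N with x <? N
  ... | yes x<N' = toℕ-fromℕ< x<N'
  ... | no x≮N = ⊥-elim (x≮N x<N)

  tabulateℕ : ∀ {N} → (ℕ → ℕ) → Vec (Fin N) N
  tabulateℕ f = tabulate (λ i → toFinOr i (f (toℕ i)))

  at-tabulateℕ : ∀ {N} (f : ℕ → ℕ) x → x < N → f x < N → at (tabulateℕ {N} f) x ≡ f x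
  at-tabulateℕ {N} f x x<N fx<N = begin
    at (tabulateℕ {N} f) x                ≡⟨ cong (at (tabulateℕ {N} f)) (sym (toℕ-fromℕ< x<N)) ⟩
    at (tabulateℕ {N} f) (toℕ i)          ≡⟨ at-lookup (tabulateℕ {N} f) i ⟩
    toℕ (lookup (tabulateℕ {N} f) i)      ≡⟨ cong toℕ (lookup∘tabulate _ i) ⟩
    toℕ (toFinOr i (f (toℕ i)))           ≡⟨ toℕ-toFinOr i _ (subst (λ z → f z < N) (sym (toℕ-fromℕ< x<N)) fx<N) ⟩
    f (toℕ i)                             ≡⟨ cong f (toℕ-fromℕ< x<N) ⟩
    f x                                   ∎
    where
    open ≡-Reasoning
    i = fromℕ< x<N

  Unique-allVecs : ∀ N k → Unique (allVecs N k)
  Unique-allVecs N zero = [] ∷ []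
  Unique-allVecs N (suc k) = subst Unique (sym (allVecs-as-product (allVecs N k)))
    (cartesianProductWith⁺ (λ v x → x ∷ v) ∷-injective (Unique-allVecs N k) (allFin⁺ N))
    where
    allVecs-as-product : ∀ (vs : List (Vec (Fin N) k)) →
      concatMap (λ v → L.map (_∷ v) (L.allFin N)) vs ≡ cartesianProductWith (λ v x → x ∷ v) vs (L.allFin N)
    allVecs-as-product L.[] = refl
    allVecs-as-product (v L.∷ vs) = cong (L.map (_∷ v) (L.allFin N) L.++_) (allVecs-as-product vs)
    ∷-injective : ∀ {w x : Vec (Fin N) k} {y z : Fin N} → (y ∷ w) ≡ (z ∷ x) → w ≡ x × y ≡ z
    ∷-injective refl = refl , refl

  sum< : ℕ → (ℕ → ℕ) → ℕ
  sum< zero f = 0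
  sum< (suc N) f = f 0 + sum< N (λ x → f (suc x))

  sum<-cong : ∀ N (f g : ℕ → ℕ) → (∀ x → x < N → f x ≡ g x) → sum< N f ≡ sum< N g
  sum<-cong zero f g h = refl
  sum<-cong (suc N) f g h = cong₂ _+_ (h 0 z<s) (sum<-cong N _ _ (λ x x<N → h (suc x) (s≤s x<N)))

  sum<-+ : ∀ a b f → sum< (a + b) f ≡ sum< a f + sum< b (λ x → f (a + x))
  sum<-+ zero b f = refl
  sum<-+ (suc a) b f rewrite sum<-+ a b (λ x → f (suc x)) = sym (+-assoc (f 0) _ _)

  sum<-suc : ∀ a f → sum< (suc a) f ≡ sum< a f + f a
  sum<-suc a f = begin
    sum< (suc a) f              ≡⟨ cong (λ z → sum< z f) (+-comm 1 a) ⟩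
    sum< (a + 1) f              ≡⟨ sum<-+ a 1 f ⟩
    sum< a f + (f (a + 0) + 0)  ≡⟨ cong (sum< a f +_) (trans (+-identityʳ _) (cong f (+-identityʳ a))) ⟩
    sum< a f + f a              ∎
    where open ≡-Reasoning

  sum<-zero : ∀ N f → (∀ x → x < N → f x ≡ 0) → sum< N f ≡ 0
  sum<-zero zero f h = refl
  sum<-zero (suc N) f h rewrite h 0 z<s = sum<-zero N _ (λ x x<N → h (suc x) (s≤s x<N))

  sum<-distrib : ∀ N f g → sum< N (λ x → f x + g x) ≡ sum< N f + sum< N g
  sum<-distrib zero f g = refl
  sum<-distrib (suc N) f g rewrite sum<-distrib N (λ x → f (suc x)) (λ x → g (suc x)) =
    +-interchange (f 0) (g 0) (sum< N (λ x → f (suc x))) (sum< N (λ x → g (suc x)))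

  sum<-const-1 : ∀ N → sum< N (λ _ → 1) ≡ N
  sum<-const-1 zero = refl
  sum<-const-1 (suc N) = cong suc (sum<-const-1 N)

  count-tabulate : ∀ {A : Set} {P : A → Set} (P? : Decidable P) N (h : Fin N → A) (g : ℕ → ℕ) →
    (∀ i → 𝟙 (P? (h i)) ≡ g (toℕ i)) → count P? (L.tabulate h) ≡ sum< N g
  count-tabulate P? zero h g e = refl
  count-tabulate P? (suc N) h g e = trans (count-∷ P? (h F.zero) _)
    (cong₂ _+_ (e F.zero) (count-tabulate P? N (λ i → h (F.suc i)) (λ x → g (suc x)) (λ i → e (F.suc i))))

  numOneArcs-≤ : ∀ {N} (v : Vec (Fin N) N) → numOneArcs N (lookup v) ≤ N
  numOneArcs-≤ {N} v = subst (numOneArcs N (lookup v) ≤_) (length-tabulate {n = N} (λ i → i))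
                             (length-filter (λ i → toℕ (lookup v i) ≟ suc (toℕ i)) (L.allFin N))

  oneArcs : ℕ → (ℕ → ℕ) → ℕ
  oneArcs N q = sum< N (λ x → 𝟙 (q x ≟ suc x))

  numOneArcs≡oneArcs : ∀ {N} (v : Vec (Fin N) N) → numOneArcs N (lookup v) ≡ oneArcs N (at v)
  numOneArcs≡oneArcs {N} v = count-tabulate _ N (λ i → i) _
    (λ i → 𝟙-cong _ _ (trans (at-lookup v i)) (trans (sym (at-lookup v i))))

  Closed : ℕ → (ℕ → ℕ) → Set
  Closed N q = ∀ x → x < N → q x < N

  IsMatchingℕ : ℕ → (ℕ → ℕ) → Set
  IsMatchingℕ N q = (∀ x → x < N → q (q x) ≡ x) × (∀ x → x < N → q x ≢ x)

  HasCrossingℕ : ℕ → ℕ → (ℕ → ℕ) → Set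
  HasCrossingℕ N k q = Σ (Fin k → ℕ) λ c → (∀ s → c s < N) × (∀ s t → s F.< t → c s < c t) ×
     (∀ s t → s F.< t → q (c s) < q (c t)) × (∀ s t → c s < q (c t))

  IsMatching⇒IsMatchingℕ : ∀ {N} (v : Vec (Fin N) N) → IsMatching N (lookup v) → IsMatchingℕ N (at v)
  IsMatching⇒IsMatchingℕ {N} v (invol , no-fix) = invol′ , no-fix′
    where
    invol′ : ∀ x → x < N → at v (at v x) ≡ x
    invol′ x x<N = begin
      at v (at v x)                ≡⟨ cong (λ z → at v (at v z)) (sym (toℕ-fromℕ< x<N)) ⟩
      at v (at v (toℕ i))          ≡⟨ cong (at v) (at-lookup v i) ⟩
      at v (toℕ (lookup v i))      ≡⟨ at-lookup v (lookup v i) ⟩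
      toℕ (lookup v (lookup v i))  ≡⟨ cong toℕ (invol i) ⟩
      toℕ i                        ≡⟨ toℕ-fromℕ< x<N ⟩
      x                            ∎
      where
      open ≡-Reasoning
      i = fromℕ< x<N
    no-fix′ : ∀ x → x < N → at v x ≢ x
    no-fix′ x x<N e = no-fix i (toℕ-injective (begin
      toℕ (lookup v i)  ≡⟨ sym (at-lookup v i) ⟩
      at v (toℕ i)      ≡⟨ cong (at v) (toℕ-fromℕ< x<N) ⟩
      at v x            ≡⟨ e ⟩
      x                 ≡⟨ sym (toℕ-fromℕ< x<N) ⟩
      toℕ i             ∎))
      where
      open ≡-Reasoning
      i = fromℕ< x<N

  IsMatchingℕ⇒IsMatching : ∀ {N} (v : Vec (Fin N) N) → IsMatchingℕ N (at v) → IsMatching N (lookup v)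
  IsMatchingℕ⇒IsMatching v (invol , no-fix) =
    (λ i → toℕ-injective (trans (sym (at-lookup v (lookup v i)))
                           (trans (cong (at v) (sym (at-lookup v i))) (invol (toℕ i) (toℕ<n i))))) ,
    (λ i e → no-fix (toℕ i) (toℕ<n i) (trans (at-lookup v i) (cong toℕ e)))

  HasKCrossing⇒HasCrossingℕ : ∀ {N k} (v : Vec (Fin N) N) → HasKCrossing N k (lookup v) → HasCrossingℕ N k (at v)
  HasKCrossing⇒HasCrossingℕ v (c , left< , right< , left<right) =
    (λ s → toℕ (lookup c s)) , (λ s → toℕ<n _) , left< ,
    (λ s t s<t → subst₂ _<_ (sym (at-lookup v _)) (sym (at-lookup v _)) (right< s t s<t)) ,
    (λ s t → subst (_ <_) (sym (at-lookup v _)) (left<right s t))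

  HasCrossingℕ⇒HasKCrossing : ∀ {N k} (v : Vec (Fin N) N) → HasCrossingℕ N k (at v) → HasKCrossing N k (lookup v)
  HasCrossingℕ⇒HasKCrossing {N} {k} v (c , c<N , left< , right< , left<right) =
    c′ , (λ s t s<t → subst₂ _<_ (sym (toℕ-c′ s)) (sym (toℕ-c′ t)) (left< s t s<t)) ,
    (λ s t s<t → subst₂ _<_ (partner s) (partner t) (right< s t s<t)) ,
    (λ s t → subst₂ _<_ (sym (toℕ-c′ s)) (partner t) (left<right s t))
    where
    c′ : Vec (Fin N) k
    c′ = tabulate (λ s → fromℕ< (c<N s))
    toℕ-c′ : ∀ s → toℕ (lookup c′ s) ≡ c s
    toℕ-c′ s = trans (cong toℕ (lookup∘tabulate _ s)) (toℕ-fromℕ< (c<N s))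
    partner : ∀ s → at v (c s) ≡ toℕ (lookup v (lookup c′ s))
    partner s = trans (cong (at v) (sym (toℕ-c′ s))) (at-lookup v _)

  module _ (N : ℕ) {q r : ℕ → ℕ} (q≗r : ∀ x → x < N → q x ≡ r x) where

    IsMatchingℕ-resp : Closed N q → IsMatchingℕ N q → IsMatchingℕ N r
    IsMatchingℕ-resp closed (invol , no-fix) =
      (λ x x<N → trans (cong r (sym (q≗r x x<N))) (trans (sym (q≗r (q x) (closed x x<N))) (invol x x<N))) ,
      (λ x x<N e → no-fix x x<N (trans (q≗r x x<N) e))

    HasCrossingℕ-resp : ∀ {k} → HasCrossingℕ N k q → HasCrossingℕ N k r
    HasCrossingℕ-resp (c , c<N , left< , right< , left<right) = c , c<N , left< ,
      (λ s t s<t → subst₂ _<_ (q≗r _ (c<N s)) (q≗r _ (c<N t)) (right< s t s<t)) ,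
      (λ s t → subst (_ <_) (q≗r _ (c<N t)) (left<right s t))

    oneArcs-resp : oneArcs N q ≡ oneArcs N r
    oneArcs-resp = sum<-cong N _ _ (λ x x<N → 𝟙-cong _ _ (trans (sym (q≗r x x<N))) (trans (q≗r x x<N)))


module Insertion where

  open import Data.Nat
  open import Data.Nat.Properties
  open import Data.Fin as F using (Fin)
  open import Data.Product using (Σ-syntax; _×_; _,_)
  open import Data.Sum using (_⊎_; inj₁; inj₂)
  open import Relation.Nullary using (yes; no)
  open import Relation.Binary.PropositionalEquality
  open import Relation.Binary.Definitions using (tri<; tri≈; tri>)
  open import Function using (_∘_)
  open import Data.Empty using (⊥-elim)
  open Encoding

  -- Inserting the 1-arc (j, j+1) moves every vertex y ≥ j two places to the right.
  shift : ℕ → ℕ → ℕ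
  shift j y with y <? j
  ... | yes _ = y
  ... | no _ = suc (suc y)

  unshift : ℕ → ℕ → ℕ
  unshift j z with z <? j
  ... | yes _ = z
  ... | no _ = z ∸ 2

  insertArc : ℕ → (ℕ → ℕ) → ℕ → ℕ
  insertArc j q x with x ≟ j
  ... | yes _ = suc j
  ... | no _ with x ≟ suc j
  ... | yes _ = j
  ... | no _ = shift j (q (unshift j x))

  removeArc : ℕ → (ℕ → ℕ) → ℕ → ℕ
  removeArc i Q x = unshift i (Q (shift i x))

  shift-< : ∀ {j y} → y < j → shift j y ≡ y
  shift-< {j} {y} y<j with y <? j
  ... | yes _ = refl
  ... | no y≮j = ⊥-elim (y≮j y<j)

  shift-≥ : ∀ {j y} → j ≤ y → shift j y ≡ suc (suc y)
  shift-≥ {j} {y} j≤y with y <? j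
  ... | yes y<j = ⊥-elim (<⇒≱ y<j j≤y)
  ... | no _ = refl

  unshift-< : ∀ {j z} → z < j → unshift j z ≡ z
  unshift-< {j} {z} z<j with z <? j
  ... | yes _ = refl
  ... | no z≮j = ⊥-elim (z≮j z<j)

  unshift-≥ : ∀ {j z} → j ≤ z → unshift j z ≡ z ∸ 2
  unshift-≥ {j} {z} j≤z with z <? j
  ... | yes z<j = ⊥-elim (<⇒≱ z<j j≤z)
  ... | no _ = refl

  insertArc-left : ∀ j q → insertArc j q j ≡ suc j
  insertArc-left j q with j ≟ j
  ... | yes _ = refl
  ... | no j≢j = ⊥-elim (j≢j refl)

  insertArc-right : ∀ j q → insertArc j q (suc j) ≡ j
  insertArc-right j q with suc j ≟ j
  ... | yes e = ⊥-elim (1+n≢n e)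
  ... | no _ with suc j ≟ suc j
  ... | yes _ = refl
  ... | no sj≢sj = ⊥-elim (sj≢sj refl)

  insertArc-other : ∀ j q x → x ≢ j → x ≢ suc j → insertArc j q x ≡ shift j (q (unshift j x))
  insertArc-other j q x x≢j x≢sj with x ≟ j
  ... | yes e = ⊥-elim (x≢j e)
  ... | no _ with x ≟ suc j
  ... | yes e = ⊥-elim (x≢sj e)
  ... | no _ = refl

  shift≢left : ∀ j y → shift j y ≢ j
  shift≢left j y e with y <? j
  ... | yes y<j = <⇒≢ y<j e
  ... | no y≮j = y≮j (subst (y <_) e (m<n⇒m<1+n (n<1+n y)))

  shift≢right : ∀ j y → shift j y ≢ suc j
  shift≢right j y e with y <? j
  ... | yes y<j = <⇒≢ (m<n⇒m<1+n y<j) e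
  ... | no y≮j = y≮j (≤-reflexive (suc-injective e))

  unshift-shift : ∀ j y → unshift j (shift j y) ≡ y
  unshift-shift j y with y <? j
  ... | yes y<j = unshift-< y<j
  ... | no y≮j = unshift-≥ (≤-trans (≮⇒≥ y≮j) (≤-trans (n≤1+n y) (n≤1+n (suc y))))

  private
    pastArc : ∀ {j x} → j ≤ x → x ≢ j → x ≢ suc j → suc (suc j) ≤ x
    pastArc j≤x x≢j x≢sj = ≤∧≢⇒< (≤∧≢⇒< j≤x (x≢j ∘ sym)) (x≢sj ∘ sym)

  shift-unshift : ∀ j x → x ≢ j → x ≢ suc j → shift j (unshift j x) ≡ x
  shift-unshift j x x≢j x≢sj with x <? j
  ... | yes x<j = shift-< x<j
  ... | no x≮j with pastArc (≮⇒≥ x≮j) x≢j x≢sj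
  ... | past = trans (shift-≥ (∸-monoˡ-≤ 2 past)) (m+[n∸m]≡n (≤-trans (s≤s (s≤s z≤n)) past))

  shift-mono-< : ∀ j {a b} → a < b → shift j a < shift j b
  shift-mono-< j {a} {b} a<b with a <? j | b <? j
  ... | yes _ | yes _ = a<b
  ... | yes _ | no _ = m<n⇒m<1+n (m<n⇒m<1+n a<b)
  ... | no a≮j | yes b<j = ⊥-elim (a≮j (<-trans a<b b<j))
  ... | no _ | no _ = s<s (s<s a<b)

  shift-injective : ∀ j {a b} → shift j a ≡ shift j b → a ≡ b
  shift-injective j {a} {b} e = trans (sym (unshift-shift j a)) (trans (cong (unshift j) e) (unshift-shift j b))

  shift-cancel-< : ∀ j {a b} → shift j a < shift j b → a < b
  shift-cancel-< j {a} {b} sa<sb with <-cmp a b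
  ... | tri< a<b _ _ = a<b
  ... | tri≈ _ refl _ = ⊥-elim (<-irrefl refl sa<sb)
  ... | tri> _ _ b<a = ⊥-elim (<-asym sa<sb (shift-mono-< j b<a))

  shift-<-bound : ∀ j {N y} → y < N → shift j y < suc (suc N)
  shift-<-bound j {N} {y} y<N with y <? j
  ... | yes _ = m<n⇒m<1+n (m<n⇒m<1+n y<N)
  ... | no _ = s<s (s<s y<N)

  insertArc-shift : ∀ j q y → insertArc j q (shift j y) ≡ shift j (q y)
  insertArc-shift j q y = trans (insertArc-other j q _ (shift≢left j y) (shift≢right j y))
                                (cong (shift j ∘ q) (unshift-shift j y))

  data InsertionView (j N x : ℕ) : Set where
    left : x ≡ j → InsertionView j N x
    right : x ≡ suc j → InsertionView j N x
    shifted : ∀ y → y < N → shift j y ≡ x → InsertionView j N x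

  insertionView : ∀ j N x → j ≤ N → x < suc (suc N) → InsertionView j N x
  insertionView j N x j≤N x<N+2 with x ≟ j | x ≟ suc j | x <? j
  ... | yes x≡j | _ | _ = left x≡j
  ... | no _ | yes x≡sj | _ = right x≡sj
  ... | no _ | no _ | yes x<j = shifted x (<-≤-trans x<j j≤N) (shift-< x<j)
  ... | no x≢j | no x≢sj | no x≮j = past x (pastArc (≮⇒≥ x≮j) x≢j x≢sj) x<N+2
    where
    past : ∀ x → suc (suc j) ≤ x → x < suc (suc N) → InsertionView j N x
    past (suc (suc y)) (s≤s (s≤s j≤y)) (s≤s (s≤s y<N)) = shifted y y<N (shift-≥ j≤y)

  insertArc-resp : ∀ j N {q r} → j ≤ N → (∀ y → y < N → q y ≡ r y) →
    ∀ x → x < suc (suc N) → insertArc j q x ≡ insertArc j r x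
  insertArc-resp j N {q} {r} j≤N q≗r x x<N+2 with insertionView j N x j≤N x<N+2
  ... | left refl = trans (insertArc-left j q) (sym (insertArc-left j r))
  ... | right refl = trans (insertArc-right j q) (sym (insertArc-right j r))
  ... | shifted y y<N refl = trans (insertArc-shift j q y) (trans (cong (shift j) (q≗r y y<N)) (sym (insertArc-shift j r y)))

  Closed-insertArc : ∀ j N q → j ≤ N → Closed N q → Closed (suc (suc N)) (insertArc j q)
  Closed-insertArc j N q j≤N closed x x<N+2 with insertionView j N x j≤N x<N+2
  ... | left refl = subst (_< suc (suc N)) (sym (insertArc-left j q)) (s≤s (s≤s j≤N))
  ... | right refl = subst (_< suc (suc N)) (sym (insertArc-right j q)) (m<n⇒m<1+n (s≤s j≤N))
  ... | shifted y y<N refl = subst (_< suc (suc N)) (sym (insertArc-shift j q y)) (shift-<-bound j (closed y y<N))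

  IsMatchingℕ-insertArc : ∀ j N q → j ≤ N → Closed N q → IsMatchingℕ N q → IsMatchingℕ (suc (suc N)) (insertArc j q)
  IsMatchingℕ-insertArc j N q j≤N closed (invol , no-fix) = invol′ , no-fix′
    where
    Q = insertArc j q
    invol′ : ∀ x → x < suc (suc N) → Q (Q x) ≡ x
    invol′ x x<N+2 with insertionView j N x j≤N x<N+2
    ... | left refl = trans (cong Q (insertArc-left j q)) (insertArc-right j q)
    ... | right refl = trans (cong Q (insertArc-right j q)) (insertArc-left j q)
    ... | shifted y y<N refl =
      trans (cong Q (insertArc-shift j q y)) (trans (insertArc-shift j q (q y)) (cong (shift j) (invol y y<N)))
    no-fix′ : ∀ x → x < suc (suc N) → Q x ≢ x
    no-fix′ x x<N+2 e with insertionView j N x j≤N x<N+2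
    ... | left refl = 1+n≢n (trans (sym (insertArc-left j q)) e)
    ... | right refl = 1+n≢n (sym (trans (sym (insertArc-right j q)) e))
    ... | shifted y y<N refl = no-fix y y<N (shift-injective j (trans (sym (insertArc-shift j q y)) e))

  IsMatchingℕ-insertArc⁻ : ∀ j N q → IsMatchingℕ (suc (suc N)) (insertArc j q) → IsMatchingℕ N q
  IsMatchingℕ-insertArc⁻ j N q (invol , no-fix) =
    (λ y y<N → shift-injective j (trans (sym (trans (cong (insertArc j q) (insertArc-shift j q y)) (insertArc-shift j q (q y))))
                                        (invol (shift j y) (shift-<-bound j y<N)))) ,
    (λ y y<N e → no-fix (shift j y) (shift-<-bound j y<N) (trans (insertArc-shift j q y) (cong (shift j) e)))

  HasCrossingℕ-insertArc : ∀ j N k q → HasCrossingℕ N k q → HasCrossingℕ (suc (suc N)) k (insertArc j q)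
  HasCrossingℕ-insertArc j N k q (c , c<N , left< , right< , left<right) =
    shift j ∘ c , (λ s → shift-<-bound j (c<N s)) ,
    (λ s t s<t → shift-mono-< j (left< s t s<t)) ,
    (λ s t s<t → subst₂ _<_ (sym (insertArc-shift j q (c s))) (sym (insertArc-shift j q (c t))) (shift-mono-< j (right< s t s<t))) ,
    (λ s t → subst (shift j (c s) <_) (sym (insertArc-shift j q (c t))) (shift-mono-< j (left<right s t)))

  -- A 1-arc crosses no other arc, so a crossing of two or more arcs avoids the inserted one.
  HasCrossingℕ-insertArc⁻ : ∀ j N k q → 2 ≤ k → j ≤ N → HasCrossingℕ (suc (suc N)) k (insertArc j q) →
    HasCrossingℕ N k q
  HasCrossingℕ-insertArc⁻ j N k q 2≤k j≤N (c , c<N+2 , left< , right< , left<right) =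
    unshift j ∘ c , c′<N , left<′ , right<′ , left<right′
    where
    Q = insertArc j q
    another : ∀ {k} → 2 ≤ k → (t : Fin k) → Σ[ s ∈ Fin k ] (s F.< t ⊎ t F.< s)
    another (s≤s (s≤s _)) F.zero = F.suc F.zero , inj₂ (s≤s z≤n)
    another (s≤s (s≤s _)) (F.suc t) = F.zero , inj₁ (s≤s z≤n)
    c≢left : ∀ t → c t ≢ j
    c≢left t e with another 2≤k t
    ... | s , inj₁ s<t = <⇒≱ (subst (_< Q (c s)) e (left<right t s))
                             (≤-pred (subst (Q (c s) <_) (trans (cong Q e) (insertArc-left j q)) (right< s t s<t)))
    ... | s , inj₂ t<s = <⇒≱ (subst (_< c s) e (left< t s t<s))
                             (≤-pred (subst (c s <_) (trans (cong Q e) (insertArc-left j q)) (left<right s t)))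
    c≢right : ∀ t → c t ≢ suc j
    c≢right t e = <-irrefl refl (<-trans (subst (_< Q (c t)) e (left<right t t))
                                         (subst (_< suc j) (sym (trans (cong Q e) (insertArc-right j q))) (n<1+n j)))
    shift-c′ : ∀ t → shift j (unshift j (c t)) ≡ c t
    shift-c′ t = shift-unshift j (c t) (c≢left t) (c≢right t)
    Q-c : ∀ t → Q (c t) ≡ shift j (q (unshift j (c t)))
    Q-c t = trans (cong Q (sym (shift-c′ t))) (insertArc-shift j q _)
    c′<N : ∀ s → unshift j (c s) < N
    c′<N s with insertionView j N (c s) j≤N (c<N+2 s)
    ... | left e = ⊥-elim (c≢left s e)
    ... | right e = ⊥-elim (c≢right s e)
    ... | shifted y y<N e = subst (_< N) (trans (sym (unshift-shift j y)) (cong (unshift j) e)) y<N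
    left<′ : ∀ s t → s F.< t → unshift j (c s) < unshift j (c t)
    left<′ s t s<t = shift-cancel-< j (subst₂ _<_ (sym (shift-c′ s)) (sym (shift-c′ t)) (left< s t s<t))
    right<′ : ∀ s t → s F.< t → q (unshift j (c s)) < q (unshift j (c t))
    right<′ s t s<t = shift-cancel-< j (subst₂ _<_ (Q-c s) (Q-c t) (right< s t s<t))
    left<right′ : ∀ s t → unshift j (c s) < q (unshift j (c t))
    left<right′ s t = shift-cancel-< j (subst₂ _<_ (sym (shift-c′ s)) (Q-c t) (left<right s t))

  removeArc-insertArc : ∀ j q y → removeArc j (insertArc j q) y ≡ q y
  removeArc-insertArc j q y = trans (cong (unshift j) (insertArc-shift j q y)) (unshift-shift j (q y))

  removeArc-1-arc : ∀ i N Q → i < suc (suc N) → Closed (suc (suc N)) Q → IsMatchingℕ (suc (suc N)) Q → Q i ≡ suc i →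
    (i ≤ N) × Closed N (removeArc i Q) × (∀ x → x < suc (suc N) → insertArc i (removeArc i Q) x ≡ Q x)
  removeArc-1-arc i N Q i<N+2 closed (invol , _) Qi≡si = i≤N , closed′ , reinsert
    where
    i≤N : i ≤ N
    i≤N = ≤-pred (≤-pred (subst (_< suc (suc N)) Qi≡si (closed i i<N+2)))
    Q-shift≢left : ∀ y → y < N → Q (shift i y) ≢ i
    Q-shift≢left y y<N e = shift≢right i y (trans (sym (invol _ (shift-<-bound i y<N))) (trans (cong Q e) Qi≡si))
    Q-shift≢right : ∀ y → y < N → Q (shift i y) ≢ suc i
    Q-shift≢right y y<N e =
      shift≢left i y (trans (sym (invol _ (shift-<-bound i y<N))) (trans (cong Q (trans e (sym Qi≡si))) (invol i i<N+2)))
    closed′ : Closed N (removeArc i Q)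
    closed′ y y<N with insertionView i N (Q (shift i y)) i≤N (closed _ (shift-<-bound i y<N))
    ... | left e = ⊥-elim (Q-shift≢left y y<N e)
    ... | right e = ⊥-elim (Q-shift≢right y y<N e)
    ... | shifted z z<N e = subst (_< N) (trans (sym (unshift-shift i z)) (cong (unshift i) e)) z<N
    reinsert : ∀ x → x < suc (suc N) → insertArc i (removeArc i Q) x ≡ Q x
    reinsert x x<N+2 with insertionView i N x i≤N x<N+2
    ... | left refl = trans (insertArc-left i _) (sym Qi≡si)
    ... | right refl = trans (insertArc-right i _) (sym (trans (cong Q (sym Qi≡si)) (invol i i<N+2)))
    ... | shifted y y<N refl =
      trans (insertArc-shift i _ y) (shift-unshift i _ (Q-shift≢left y y<N) (Q-shift≢right y y<N))


module OneArcs where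

  open import Data.Nat
  open import Data.Nat.Properties
  open import Data.Sum using (_⊎_; inj₁; inj₂)
  open import Relation.Nullary using (yes; no)
  open import Relation.Binary.PropositionalEquality
  open import Function using (_∘_)
  open import Data.Empty using (⊥-elim)
  open Counting
  open Encoding
  open Insertion

  splitsOneArc : ℕ → (ℕ → ℕ) → ℕ
  splitsOneArc zero q = 0
  splitsOneArc (suc x) q = 𝟙 (q x ≟ suc x)

  splitsOneArc-01 : ∀ j q → splitsOneArc j q ≡ 0 ⊎ splitsOneArc j q ≡ 1
  splitsOneArc-01 zero q = inj₁ refl
  splitsOneArc-01 (suc x) q with q x ≟ suc x
  ... | yes _ = inj₂ refl
  ... | no _ = inj₁ refl

  module _ (j : ℕ) (q : ℕ → ℕ) where

    private
      after before : ℕ → ℕ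
      after x = 𝟙 (insertArc j q x ≟ suc x)
      before x = 𝟙 (q x ≟ suc x)

      insertArc-below : ∀ x → x < j → insertArc j q x ≡ shift j (q x)
      insertArc-below x x<j = trans (insertArc-other j q x (<⇒≢ x<j) (<⇒≢ (m<n⇒m<1+n x<j)))
                                    (cong (shift j ∘ q) (unshift-< x<j))

      after-below : ∀ x → suc x < j → after x ≡ before x
      after-below x sx<j = 𝟙-cong _ _ to from
        where
        e : insertArc j q x ≡ shift j (q x)
        e = insertArc-below x (<-trans (n<1+n x) sx<j)
        to : insertArc j q x ≡ suc x → q x ≡ suc x
        to h with q x <? j
        ... | yes qx<j = trans (sym (shift-< qx<j)) (trans (sym e) h)
        ... | no qx≮j = ⊥-elim (<⇒≱ sx<j (≤-trans (≮⇒≥ qx≮j) (≤-trans (n≤1+n _) (≤-trans (n≤1+n _)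
                          (≤-reflexive (trans (sym (shift-≥ (≮⇒≥ qx≮j))) (trans (sym e) h)))))))
        from : q x ≡ suc x → insertArc j q x ≡ suc x
        from h = trans e (trans (shift-< (subst (_< j) (sym h) sx<j)) h)

      after-last : ∀ a → suc a ≡ j → after a ≡ 0
      after-last a sa≡j =
        𝟙-no _ (λ h → shift≢left j (q a) (trans (sym (insertArc-below a (subst (a <_) sa≡j (n<1+n a)))) (trans h sa≡j)))

      after-left : after (j + 0) ≡ 1
      after-left rewrite +-identityʳ j = 𝟙-yes _ (insertArc-left j q)

      after-right : after (j + 1) ≡ 0
      after-right rewrite +-comm j 1 = 𝟙-no _ (λ h → <⇒≢ (m<n⇒m<1+n (n<1+n j)) (trans (sym (insertArc-right j q)) h))

      after-above : ∀ x → after (j + suc (suc x)) ≡ before (j + x)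
      after-above x = 𝟙-cong _ _ to from
        where
        j+2+x : j + suc (suc x) ≡ suc (suc (j + x))
        j+2+x = trans (+-suc j (suc x)) (cong suc (+-suc j x))
        e : insertArc j q (j + suc (suc x)) ≡ shift j (q (j + x))
        e = trans (cong (insertArc j q) (trans j+2+x (sym (shift-≥ (m≤m+n j x))))) (insertArc-shift j q (j + x))
        to : insertArc j q (j + suc (suc x)) ≡ suc (j + suc (suc x)) → q (j + x) ≡ suc (j + x)
        to h with q (j + x) <? j
        ... | yes r = ⊥-elim (<⇒≱ r (≤-trans (m≤m+n j x) (≤-trans (n≤1+n _) (≤-trans (n≤1+n _) (≤-trans (n≤1+n _)
                        (≤-reflexive (sym (trans (sym (shift-< r)) (trans (sym e) (trans h (cong suc j+2+x)))))))))))
        ... | no r = suc-injective (suc-injective (trans (sym (shift-≥ (≮⇒≥ r))) (trans (sym e) (trans h (cong suc j+2+x)))))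
        from : q (j + x) ≡ suc (j + x) → insertArc j q (j + suc (suc x)) ≡ suc (j + suc (suc x))
        from h = trans e (trans (shift-≥ (subst (j ≤_) (sym h) (≤-trans (m≤m+n j x) (n≤1+n _))))
                                (trans (cong (suc ∘ suc) h) (sym (cong suc j+2+x))))

      below-j : sum< j after + splitsOneArc j q ≡ sum< j before
      below-j = go j refl
        where
        open ≡-Reasoning
        go : ∀ a → a ≡ j → sum< a after + splitsOneArc a q ≡ sum< a before
        go zero _ = refl
        go (suc a) sa≡j = begin
          sum< (suc a) after + before a        ≡⟨ cong (_+ before a) (sum<-suc a after) ⟩
          sum< a after + after a + before a    ≡⟨ cong (λ z → sum< a after + z + before a) (after-last a sa≡j) ⟩
          sum< a after + 0 + before a          ≡⟨ cong (λ z → z + 0 + before a)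
                                                   (sum<-cong a after before (λ x x<a → after-below x (subst (suc x <_) sa≡j (s≤s x<a)))) ⟩
          sum< a before + 0 + before a         ≡⟨ cong (_+ before a) (+-identityʳ _) ⟩
          sum< a before + before a             ≡⟨ sym (sum<-suc a before) ⟩
          sum< (suc a) before                  ∎

      -- Left of j the 1-arcs are those of q less the split one, j starts the new 1-arc, and
      -- right of j+1 they are the shifted 1-arcs of q.
      oneArcs-insertArc-+ : ∀ r → oneArcs (suc (suc (j + r))) (insertArc j q) + splitsOneArc j q ≡ oneArcs (j + r) q + 1
      oneArcs-insertArc-+ r = begin
        oneArcs (suc (suc (j + r))) (insertArc j q) + ι
          ≡⟨ cong (λ z → sum< z after + ι) (sym (trans (+-suc j (suc r)) (cong suc (+-suc j r)))) ⟩
        sum< (j + suc (suc r)) after + ι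
          ≡⟨ cong (_+ ι) (sum<-+ j (suc (suc r)) after) ⟩
        sum< j after + (after (j + 0) + (after (j + 1) + sum< r (λ x → after (j + suc (suc x))))) + ι
          ≡⟨ cong₂ (λ u v → sum< j after + (u + (v + sum< r (λ x → after (j + suc (suc x))))) + ι) after-left after-right ⟩
        sum< j after + suc (sum< r (λ x → after (j + suc (suc x)))) + ι
          ≡⟨ cong (λ z → sum< j after + suc z + ι) (sum<-cong r _ _ (λ x _ → after-above x)) ⟩
        sum< j after + suc R + ι
          ≡⟨ rearrange (sum< j after) R ι ⟩
        (sum< j after + ι) + R + 1
          ≡⟨ cong (λ z → z + R + 1) below-j ⟩
        sum< j before + R + 1
          ≡⟨ cong (_+ 1) (sym (sum<-+ j r before)) ⟩
        oneArcs (j + r) q + 1 ∎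
        where
        open ≡-Reasoning
        ι = splitsOneArc j q
        R = sum< r (λ x → before (j + x))
        rearrange : ∀ a b c → a + suc b + c ≡ a + c + b + 1
        rearrange a b c rewrite +-suc a b | +-assoc a b c | +-comm b c | sym (+-assoc a c b) | +-comm (a + c + b) 1 = refl

    oneArcs-insertArc : ∀ N → j ≤ N → oneArcs (suc (suc N)) (insertArc j q) + splitsOneArc j q ≡ oneArcs N q + 1
    oneArcs-insertArc N j≤N =
      subst (λ z → oneArcs (suc (suc z)) (insertArc j q) + splitsOneArc j q ≡ oneArcs z q + 1)
            (m+[n∸m]≡n j≤N) (oneArcs-insertArc-+ (N ∸ j))


module Recurrence where

  open import Data.Nat
  open import Data.Nat.Properties
  open import Data.Fin as F using (Fin; toℕ)
  open import Data.Fin.Properties using (toℕ-injective; toℕ<n) renaming (_≟_ to _≟F_)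
  open import Data.Vec using (Vec; lookup)
  import Data.Vec.Properties as Vec
  import Data.Product.Properties as Product
  open import Data.List using (allFin; cartesianProduct)
  open import Data.List.Membership.Propositional.Properties using (∈-cartesianProduct⁺; ∈-allFin)
  open import Data.List.Relation.Unary.Unique.Propositional.Properties using (cartesianProduct⁺; allFin⁺)
  open import Data.Product using (_×_; _,_; proj₁; proj₂)
  open import Data.Sum using (inj₁; inj₂)
  open import Relation.Nullary using (Dec; yes; no; ¬_)
  open import Relation.Nullary.Decidable using (_×-dec_; ¬?)
  open import Relation.Binary.PropositionalEquality
  open import Data.Empty using (⊥-elim)
  open import Data.Nat.Solver using (module +-*-Solver)
  open +-*-Solver
  open import Defs
  open Counting
  open Encoding
  open Insertion
  open OneArcs

  countMatchings : ℕ → ℕ → ℕ → ℕ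
  countMatchings k N m = count (λ v → isMatching? N (lookup v) ×-dec
                                       (¬? (hasKCrossing? N k (lookup v)) ×-dec
                                        (numOneArcs N (lookup v) ≟ m)))
                               (allVecs N N)

  countMatchings-> : ∀ k N m → N < m → countMatchings k N m ≡ 0
  countMatchings-> k N m N<m =
    count-none _ (allVecs N N) (λ v p → <⇒≱ N<m (subst (_≤ N) (proj₂ (proj₂ p)) (numOneArcs-≤ v)))

  private
    module _ (N m : ℕ) (q : ℕ → ℕ) (j : ℕ) (j≤N : j ≤ N) where

      after : ℕ
      after = oneArcs (suc (suc N)) (insertArc j q)

      balance : after + splitsOneArc j q ≡ oneArcs N q + 1
      balance = oneArcs-insertArc j q N j≤N

      keeps : oneArcs N q ≡ suc m → 𝟙 (after ≟ suc m) ≡ splitsOneArc j q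
      keeps e with splitsOneArc-01 j q
      ... | inj₁ ι≡0 = trans (𝟙-no _ (λ h → 1+n≢0 (+-cancelˡ-≡ (suc m) 1 0
                                (trans (cong (_+ 1) (sym e)) (trans (sym balance) (cong₂ _+_ h ι≡0))))))
                             (sym ι≡0)
      ... | inj₂ ι≡1 = trans (𝟙-yes _ (+-cancelʳ-≡ 1 _ _ (trans (trans (cong (after +_) (sym ι≡1)) balance) (cong (_+ 1) e))))
                             (sym ι≡1)

      gains : oneArcs N q ≡ m → 𝟙 (after ≟ suc m) + splitsOneArc j q ≡ 1
      gains e with splitsOneArc-01 j q
      ... | inj₁ ι≡0 = cong₂ _+_ (𝟙-yes _ (trans (sym (+-identityʳ after))
                                    (trans (cong (after +_) (sym ι≡0)) (trans balance (trans (cong (_+ 1) e) (+-comm m 1))))))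
                                 ι≡0
      ... | inj₂ ι≡1 = cong₂ _+_ (𝟙-no _ (λ h → 1+n≢n (+-cancelʳ-≡ 1 _ _ (trans (cong₂ _+_ (sym h) (sym ι≡1))
                                                                            (trans balance (cong (_+ 1) e))))))
                                 ι≡1

      misses : oneArcs N q ≢ suc m → oneArcs N q ≢ m → 𝟙 (after ≟ suc m) ≡ 0
      misses ≢sm ≢m with splitsOneArc-01 j q
      ... | inj₁ ι≡0 = 𝟙-no _ (λ h → ≢m (+-cancelʳ-≡ 1 _ _
                          (trans (sym balance) (trans (cong₂ _+_ h ι≡0) (trans (+-identityʳ _) (+-comm 1 m))))))
      ... | inj₂ ι≡1 = 𝟙-no _ (λ h → ≢sm (+-cancelʳ-≡ 1 _ _ (sym (trans (cong₂ _+_ (sym h) (sym ι≡1)) balance))))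

  -- Of the N+1 ways to insert a 1-arc into a matching with m+1 1-arcs, exactly m+1 keep that
  -- number (those splitting a 1-arc); into one with m 1-arcs, exactly N+1-m raise it to m+1.
  insertions-with-oneArcs : ∀ N m q → sum< (suc N) (λ j → 𝟙 (oneArcs (suc (suc N)) (insertArc j q) ≟ suc m))
    ≡ 𝟙 (oneArcs N q ≟ suc m) * suc m + 𝟙 (oneArcs N q ≟ m) * (suc N ∸ m)
  insertions-with-oneArcs N m q with oneArcs N q ≟ suc m | oneArcs N q ≟ m
  ... | yes e | yes e′ = ⊥-elim (1+n≢n (trans (sym e) e′))
  ... | yes e | no _ =
    trans (sum<-cong (suc N) _ _ (λ j j<N+1 → keeps N m q j (≤-pred j<N+1) e))
          (trans e (sym (trans (+-identityʳ _) (+-identityʳ _))))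
  ... | no _ | yes e =
    begin
      sum< (suc N) inserted                ≡⟨ sym (m+n∸n≡m _ ι-total) ⟩
      sum< (suc N) inserted + ι-total ∸ ι-total  ≡⟨ cong (_∸ ι-total) total ⟩
      suc N ∸ ι-total                      ≡⟨ cong (suc N ∸_) e ⟩
      suc N ∸ m                            ≡⟨ sym (+-identityʳ _) ⟩
      1 * (suc N ∸ m)                      ∎
    where
    open ≡-Reasoning
    inserted : ℕ → ℕ
    inserted j = 𝟙 (oneArcs (suc (suc N)) (insertArc j q) ≟ suc m)
    ι-total = sum< (suc N) (λ j → splitsOneArc j q)
    total : sum< (suc N) inserted + ι-total ≡ suc N
    total = trans (sym (sum<-distrib (suc N) inserted (λ j → splitsOneArc j q)))
                  (trans (sum<-cong (suc N) _ (λ _ → 1) (λ j j<N+1 → gains N m q j (≤-pred j<N+1) e)) (sum<-const-1 (suc N)))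
  ... | no ≢sm | no ≢m = sum<-zero (suc N) _ (λ j j<N+1 → misses N m q j (≤-pred j<N+1) ≢sm ≢m)

  Admissible : ℕ → (N : ℕ) → Vec (Fin N) N → Set
  Admissible k N u = IsMatching N (lookup u) × ¬ HasKCrossing N k (lookup u)

  admissible? : ∀ k N u → Dec (Admissible k N u)
  admissible? k N u = isMatching? N (lookup u) ×-dec ¬? (hasKCrossing? N k (lookup u))

  -- Marking one of the m+1 1-arcs of a matching on [N+2] and removing it is a bijection onto
  -- the matchings on [N] together with an insertion point whose 1-arc restores m+1 1-arcs.
  module Marking (k : ℕ) (2≤k : 2 ≤ k) (N m : ℕ) where

    private
      N₂ : ℕ
      N₂ = suc (suc N)

    Counted : Vec (Fin N₂) N₂ → Set
    Counted v = IsMatching N₂ (lookup v) × (¬ HasKCrossing N₂ k (lookup v) × numOneArcs N₂ (lookup v) ≡ suc m)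

    counted? : ∀ v → Dec (Counted v)
    counted? v = isMatching? N₂ (lookup v) ×-dec (¬? (hasKCrossing? N₂ k (lookup v)) ×-dec (numOneArcs N₂ (lookup v) ≟ suc m))

    startsOneArc? : (v : Vec (Fin N₂) N₂) (i : Fin N₂) → Dec (toℕ (lookup v i) ≡ suc (toℕ i))
    startsOneArc? v i = toℕ (lookup v i) ≟ suc (toℕ i)

    restores? : (u : Vec (Fin N) N) (j : Fin (suc N)) → Dec (oneArcs N₂ (insertArc (toℕ j) (at u)) ≡ suc m)
    restores? u j = oneArcs N₂ (insertArc (toℕ j) (at u)) ≟ suc m

    Marked : Set
    Marked = Vec (Fin N₂) N₂ × Fin N₂

    Placed : Set
    Placed = Vec (Fin N) N × Fin (suc N)

    marked? : (a : Marked) → Dec (Counted (proj₁ a) × toℕ (lookup (proj₁ a) (proj₂ a)) ≡ suc (toℕ (proj₂ a)))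
    marked? (v , i) = counted? v ×-dec startsOneArc? v i

    placed? : (b : Placed) → Dec (Admissible k N (proj₁ b) × oneArcs N₂ (insertArc (toℕ (proj₂ b)) (at (proj₁ b))) ≡ suc m)
    placed? (u , j) = admissible? k N u ×-dec restores? u j

    remove : Marked → Placed
    remove (v , i) = tabulateℕ (removeArc (toℕ i) (at v)) , toFinOr F.zero (toℕ i)

    insert : Placed → Marked
    insert (u , j) = tabulateℕ (insertArc (toℕ j) (at u)) , toFinOr F.zero (toℕ j)

    module Removal (v : Vec (Fin N₂) N₂) (i : Fin N₂) (counted : Counted v)
                   (startsOneArc : toℕ (lookup v i) ≡ suc (toℕ i)) where

      private
        Q : ℕ → ℕ
        Q = at v
        a : ℕ
        a = toℕ i
        r : ℕ → ℕ
        r = removeArc a Q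
        removed : a ≤ N × Closed N r × (∀ x → x < N₂ → insertArc a r x ≡ Q x)
        removed = removeArc-1-arc a N Q (toℕ<n i) (at-< v) (IsMatching⇒IsMatchingℕ v (proj₁ counted))
                    (trans (at-lookup v i) startsOneArc)
        a≤N : a ≤ N
        a≤N = proj₁ removed
        r-closed : Closed N r
        r-closed = proj₁ (proj₂ removed)
        insert-r : ∀ x → x < N₂ → insertArc a r x ≡ Q x
        insert-r = proj₂ (proj₂ removed)
        u : Vec (Fin N) N
        u = proj₁ (remove (v , i))
        j : Fin (suc N)
        j = proj₂ (remove (v , i))
        u≗r : ∀ x → x < N → at u x ≡ r x
        u≗r x x<N = at-tabulateℕ r x x<N (r-closed x x<N)
        toℕ-j : toℕ j ≡ a
        toℕ-j = toℕ-toFinOr F.zero a (s≤s a≤N)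
        reinsert : ∀ x → x < N₂ → insertArc (toℕ j) (at u) x ≡ Q x
        reinsert x x<N₂ = trans (cong (λ z → insertArc z (at u) x) toℕ-j)
                                (trans (insertArc-resp a N a≤N u≗r x x<N₂) (insert-r x x<N₂))
        r-matching : IsMatchingℕ N r
        r-matching = IsMatchingℕ-insertArc⁻ a N r
          (IsMatchingℕ-resp N₂ (λ x x<N₂ → sym (insert-r x x<N₂)) (at-< v) (IsMatching⇒IsMatchingℕ v (proj₁ counted)))

      isPlaced : Admissible k N u × oneArcs N₂ (insertArc (toℕ j) (at u)) ≡ suc m
      isPlaced =
        (IsMatchingℕ⇒IsMatching u (IsMatchingℕ-resp N (λ x x<N → sym (u≗r x x<N)) r-closed r-matching) ,
         λ crossing → proj₁ (proj₂ counted) (HasCrossingℕ⇒HasKCrossing v (HasCrossingℕ-resp N₂ reinsert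
           (HasCrossingℕ-insertArc (toℕ j) N k (at u) (HasKCrossing⇒HasCrossingℕ u crossing))))) ,
        trans (oneArcs-resp N₂ reinsert) (trans (sym (numOneArcs≡oneArcs v)) (proj₂ (proj₂ counted)))

      insert-remove : insert (remove (v , i)) ≡ (v , i)
      insert-remove = cong₂ _,_
        (at-injective _ v (λ x x<N₂ → trans (at-tabulateℕ (insertArc (toℕ j) (at u)) x x<N₂ (subst (_< N₂) (sym (reinsert x x<N₂)) (at-< v x x<N₂)))
                                           (reinsert x x<N₂)))
        (toℕ-injective (trans (toℕ-toFinOr F.zero (toℕ j) (subst (_< N₂) (sym toℕ-j) (toℕ<n i))) toℕ-j))

    module Reinsertion (u : Vec (Fin N) N) (j : Fin (suc N)) (admissible : Admissible k N u)
                     (restores : oneArcs N₂ (insertArc (toℕ j) (at u)) ≡ suc m) where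

      private
        q : ℕ → ℕ
        q = at u
        a : ℕ
        a = toℕ j
        a≤N : a ≤ N
        a≤N = ≤-pred (toℕ<n j)
        Q : ℕ → ℕ
        Q = insertArc a q
        Q-closed : Closed N₂ Q
        Q-closed = Closed-insertArc a N q a≤N (at-< u)
        v : Vec (Fin N₂) N₂
        v = proj₁ (insert (u , j))
        i : Fin N₂
        i = proj₂ (insert (u , j))
        v≗Q : ∀ x → x < N₂ → at v x ≡ Q x
        v≗Q x x<N₂ = at-tabulateℕ Q x x<N₂ (Q-closed x x<N₂)
        toℕ-i : toℕ i ≡ a
        toℕ-i = toℕ-toFinOr F.zero a (s≤s (≤-trans a≤N (n≤1+n N)))
        removeArc≗q : ∀ x → x < N → removeArc (toℕ i) (at v) x ≡ q x
        removeArc≗q x x<N = trans (cong (λ z → removeArc z (at v) x) toℕ-i)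
                                  (trans (cong (unshift a) (v≗Q (shift a x) (shift-<-bound a x<N))) (removeArc-insertArc a q x))

      isMarked : Counted v × toℕ (lookup v i) ≡ suc (toℕ i)
      isMarked =
        (IsMatchingℕ⇒IsMatching v (IsMatchingℕ-resp N₂ (λ x x<N₂ → sym (v≗Q x x<N₂)) Q-closed
           (IsMatchingℕ-insertArc a N q a≤N (at-< u) (IsMatching⇒IsMatchingℕ u (proj₁ admissible)))) ,
         (λ crossing → proj₂ admissible (HasCrossingℕ⇒HasKCrossing u
           (HasCrossingℕ-insertArc⁻ a N k q 2≤k a≤N (HasCrossingℕ-resp N₂ v≗Q (HasKCrossing⇒HasCrossingℕ v crossing))))) ,
         trans (numOneArcs≡oneArcs v) (trans (oneArcs-resp N₂ v≗Q) restores)) ,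
        (begin
          toℕ (lookup v i)  ≡⟨ sym (at-lookup v i) ⟩
          at v (toℕ i)      ≡⟨ cong (at v) toℕ-i ⟩
          at v a            ≡⟨ v≗Q a (s≤s (≤-trans a≤N (n≤1+n N))) ⟩
          Q a               ≡⟨ insertArc-left a q ⟩
          suc a             ≡⟨ cong suc (sym toℕ-i) ⟩
          suc (toℕ i)       ∎)
        where open ≡-Reasoning

      remove-insert : remove (insert (u , j)) ≡ (u , j)
      remove-insert = cong₂ _,_
        (at-injective _ u (λ x x<N → trans (at-tabulateℕ (removeArc (toℕ i) (at v)) x x<N (subst (_< N) (sym (removeArc≗q x x<N)) (at-< u x x<N)))
                                         (removeArc≗q x x<N)))
        (toℕ-injective (trans (toℕ-toFinOr F.zero (toℕ i) (subst (_< suc N) (sym toℕ-i) (toℕ<n j))) toℕ-i))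

    count-marked≡count-placed : count marked? (cartesianProduct (allVecs N₂ N₂) (allFin N₂))
                              ≡ count placed? (cartesianProduct (allVecs N N) (allFin (suc N)))
    count-marked≡count-placed = ≤-antisym
      (count-≤-injection (Product.≡-dec (Vec.≡-dec _≟F_) _≟F_) marked? placed? _ _
        (cartesianProduct⁺ (Unique-allVecs N₂ N₂) (allFin⁺ N₂))
        (λ (u , j) _ → ∈-cartesianProduct⁺ (∈-allVecs u) (∈-allFin j)) remove
        (λ {(v , i)} (c , s) → Removal.isPlaced v i c s)
        (λ {(v , i)} {(v′ , i′)} (c , s) (c′ , s′) e →
          trans (sym (Removal.insert-remove v i c s)) (trans (cong insert e) (Removal.insert-remove v′ i′ c′ s′))))
      (count-≤-injection (Product.≡-dec (Vec.≡-dec _≟F_) _≟F_) placed? marked? _ _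
        (cartesianProduct⁺ (Unique-allVecs N N) (allFin⁺ (suc N)))
        (λ (v , i) _ → ∈-cartesianProduct⁺ (∈-allVecs v) (∈-allFin i)) insert
        (λ {(u , j)} (a , r) → Reinsertion.isMarked u j a r)
        (λ {(u , j)} {(u′ , j′)} (a , r) (a′ , r′) e →
          trans (sym (Reinsertion.remove-insert u j a r)) (trans (cong remove e) (Reinsertion.remove-insert u′ j′ a′ r′))))

  sumOver-admissible : ∀ k N m → sumOver (allVecs N N) (λ u → 𝟙 (admissible? k N u) * 𝟙 (oneArcs N (at u) ≟ m))
                                ≡ countMatchings k N m
  sumOver-admissible k N m = begin
    sumOver (allVecs N N) (λ u → 𝟙 (admissible? k N u) * 𝟙 (oneArcs N (at u) ≟ m))
      ≡⟨ sumOver-cong (allVecs N N) _ _ (λ u → 𝟙-× (admissible? k N u) (oneArcs N (at u) ≟ m) (with-oneArcs? u)) ⟩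
    sumOver (allVecs N N) (λ u → 𝟙 (with-oneArcs? u))
      ≡⟨ sumOver-𝟙 with-oneArcs? (allVecs N N) ⟩
    count with-oneArcs? (allVecs N N)
      ≡⟨ count-cong _ _ (allVecs N N) (λ u ((isM , nc) , e) → isM , nc , trans (numOneArcs≡oneArcs u) e)
                                      (λ u (isM , nc , e) → (isM , nc) , trans (sym (numOneArcs≡oneArcs u)) e) ⟩
    countMatchings k N m ∎
    where
    open ≡-Reasoning
    with-oneArcs? = λ u → admissible? k N u ×-dec (oneArcs N (at u) ≟ m)

  countMatchings-recurrence : ∀ k → 2 ≤ k → ∀ N m →
    suc m * countMatchings k (suc (suc N)) (suc m) ≡ suc m * countMatchings k N (suc m) + (suc N ∸ m) * countMatchings k N m
  countMatchings-recurrence k 2≤k N m = begin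
    suc m * countMatchings k N₂ (suc m)
      ≡⟨ sym (trans (sumOver-*ˡ (allVecs N₂ N₂) (λ v → 𝟙 (counted? v)) (suc m)) (cong (suc m *_) (sumOver-𝟙 counted? (allVecs N₂ N₂)))) ⟩
    sumOver (allVecs N₂ N₂) (λ v → suc m * 𝟙 (counted? v))
      ≡⟨ sym (sumOver-cong (allVecs N₂ N₂) _ _ marks) ⟩
    sumOver (allVecs N₂ N₂) (λ v → 𝟙 (counted? v) * count (startsOneArc? v) (allFin N₂))
      ≡⟨ sym (count-cartesianProduct counted? startsOneArc? marked? (allVecs N₂ N₂) (allFin N₂)) ⟩
    count marked? (cartesianProduct (allVecs N₂ N₂) (allFin N₂))
      ≡⟨ count-marked≡count-placed ⟩
    count placed? (cartesianProduct (allVecs N N) (allFin (suc N)))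
      ≡⟨ count-cartesianProduct (admissible? k N) restores? placed? (allVecs N N) (allFin (suc N)) ⟩
    sumOver (allVecs N N) (λ u → 𝟙 (admissible? k N u) * count (restores? u) (allFin (suc N)))
      ≡⟨ sumOver-cong (allVecs N N) _ _ places ⟩
    sumOver (allVecs N N) (λ u → suc m * (𝟙 (admissible? k N u) * 𝟙 (oneArcs N (at u) ≟ suc m))
                               + (suc N ∸ m) * (𝟙 (admissible? k N u) * 𝟙 (oneArcs N (at u) ≟ m)))
      ≡⟨ sumOver-distrib (allVecs N N) _ _ ⟩
    _ ≡⟨ cong₂ _+_ (trans (sumOver-*ˡ (allVecs N N) _ (suc m)) (cong (suc m *_) (sumOver-admissible k N (suc m))))
                   (trans (sumOver-*ˡ (allVecs N N) _ (suc N ∸ m)) (cong ((suc N ∸ m) *_) (sumOver-admissible k N m))) ⟩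
    suc m * countMatchings k N (suc m) + (suc N ∸ m) * countMatchings k N m ∎
    where
    open ≡-Reasoning
    open Marking k 2≤k N m
    N₂ = suc (suc N)
    marks : ∀ v → 𝟙 (counted? v) * count (startsOneArc? v) (allFin N₂) ≡ suc m * 𝟙 (counted? v)
    marks v with counted? v
    ... | yes (_ , _ , oneArcs≡) = trans (+-identityʳ _) (trans oneArcs≡ (sym (*-identityʳ (suc m))))
    ... | no _ = sym (*-zeroʳ (suc m))
    places : ∀ u → 𝟙 (admissible? k N u) * count (restores? u) (allFin (suc N))
                 ≡ suc m * (𝟙 (admissible? k N u) * 𝟙 (oneArcs N (at u) ≟ suc m))
                   + (suc N ∸ m) * (𝟙 (admissible? k N u) * 𝟙 (oneArcs N (at u) ≟ m))
    places u = trans (cong (𝟙 (admissible? k N u) *_)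
                       (trans (count-tabulate (restores? u) (suc N) (λ i → i) (λ j → 𝟙 (oneArcs N₂ (insertArc j (at u)) ≟ suc m)) (λ _ → refl)) (insertions-with-oneArcs N m (at u))))
      (solve 5 (λ a b c d e → a :* (b :* c :+ d :* e) := c :* (a :* b) :+ e :* (a :* d)) refl
        (𝟙 (admissible? k N u)) (𝟙 (oneArcs N (at u) ≟ suc m)) (suc m) (𝟙 (oneArcs N (at u) ≟ m)) (suc N ∸ m))


module RecurrenceInℤ where

  open import Data.Nat
  open import Data.Nat.Properties
  open import Data.Integer as ℤ using (+_; _-_)
  import Data.Integer.Properties as ℤ
  open import Data.Sum using (_⊎_; inj₁; inj₂)
  open import Relation.Nullary using (yes; no)
  open import Relation.Binary.PropositionalEquality
  open import Defs
  open Recurrence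

  private
    -- (N+1 ∸ m) c is the integer (N+1 − m) c unless the subtraction truncates, where c = 0
    ∸-*-toℤ : ∀ N m c → m ≤ suc N ⊎ c ≡ 0 → + ((suc N ∸ m) * c) ≡ (+ (N + 1) - + m) ℤ.* + c
    ∸-*-toℤ N m c (inj₁ m≤N+1) = trans (ℤ.pos-* (suc N ∸ m) c) (cong (ℤ._* + c) (sym (begin
      + (N + 1) - + m     ≡⟨ cong (λ z → + z - + m) (+-comm N 1) ⟩
      + suc N - + m       ≡⟨ ℤ.m-n≡m⊖n (suc N) m ⟩
      suc N ℤ.⊖ m         ≡⟨ ℤ.⊖-≥ m≤N+1 ⟩
      + (suc N ∸ m)       ∎)))
      where open ≡-Reasoning
    ∸-*-toℤ N m c (inj₂ refl) = trans (cong +_ (*-zeroʳ (suc N ∸ m))) (sym (ℤ.*-zeroʳ (+ (N + 1) - + m)))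

    ≤-or-vanishes : ∀ N m {c} → (N < m → c ≡ 0) → m ≤ suc N ⊎ c ≡ 0
    ≤-or-vanishes N m vanishes with m ≤? suc N
    ... | yes m≤N+1 = inj₁ m≤N+1
    ... | no m≰N+1 = inj₂ (vanishes (<-trans (n<1+n N) (≰⇒> m≰N+1)))

    recurrence-toℤ : ∀ N m a b c → suc m * a ≡ suc m * b + (suc N ∸ m) * c → m ≤ suc N ⊎ c ≡ 0 →
      + (suc m) ℤ.* + a ≡ + (suc m) ℤ.* + b ℤ.+ (+ (N + 1) - + m) ℤ.* + c
    recurrence-toℤ N m a b c e truncation = begin
      + (suc m) ℤ.* + a                                   ≡⟨ sym (ℤ.pos-* (suc m) a) ⟩
      + (suc m * a)                                       ≡⟨ cong +_ e ⟩
      + (suc m * b + (suc N ∸ m) * c)                     ≡⟨ ℤ.pos-+ (suc m * b) _ ⟩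
      + (suc m * b) ℤ.+ + ((suc N ∸ m) * c)               ≡⟨ cong₂ ℤ._+_ (ℤ.pos-* (suc m) b) (∸-*-toℤ N m c truncation) ⟩
      + (suc m) ℤ.* + b ℤ.+ (+ (N + 1) - + m) ℤ.* + c     ∎
      where open ≡-Reasoning

  gk-recurrence : ∀ k → 2 ≤ k → ∀ n m →
    + (suc m) ℤ.* + gk k (suc n) (suc m) ≡ + (suc m) ℤ.* + gk k n (suc m) ℤ.+ (+ (2 * n + 1) - + m) ℤ.* + gk k n m
  gk-recurrence k 2≤k n m =
    recurrence-toℤ (2 * n) m (gk k (suc n) (suc m)) (gk k n (suc m)) (gk k n m)
      (subst (λ N₂ → suc m * countMatchings k N₂ (suc m) ≡ suc m * gk k n (suc m) + (suc (2 * n) ∸ m) * gk k n m)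
             (sym (*-suc 2 n)) (countMatchings-recurrence k 2≤k (2 * n) m))
      (≤-or-vanishes (2 * n) m (countMatchings-> k (2 * n) m))


module Sums where

  open import Data.Nat as ℕ using (ℕ; zero; suc; _≤_; _<_; s≤s; z≤n; _∸_)
  import Data.Nat.Properties as ℕ
  open import Data.Nat.Combinatorics using (_C_; nCn≡1; nC1≡n; nCk+nC[k+1]≡[n+1]C[k+1])
  open import Algebra.Properties.CommutativeSemigroup ℕ.+-commutativeSemigroup
    using (x∙yz≈y∙xz) renaming (interchange to +-interchange)
  open import Data.Integer as ℤ using (ℤ; +_; _+_; _*_)
  import Data.Integer.Properties as ℤ
  open import Data.Sum using (inj₁; inj₂)
  open import Relation.Binary.PropositionalEquality
  open import Data.Integer.Solver using (module +-*-Solver)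
  open +-*-Solver
  open import Defs using (sumTo)

  sumTo-cong : ∀ n f g → (∀ i → i ≤ n → f i ≡ g i) → sumTo n f ≡ sumTo n g
  sumTo-cong zero f g h = h 0 z≤n
  sumTo-cong (suc n) f g h = cong₂ _+_ (sumTo-cong n f g (λ i i≤n → h i (ℕ.m≤n⇒m≤1+n i≤n))) (h (suc n) ℕ.≤-refl)

  sumTo-distrib : ∀ n f g → sumTo n (λ i → f i + g i) ≡ sumTo n f + sumTo n g
  sumTo-distrib zero f g = refl
  sumTo-distrib (suc n) f g rewrite sumTo-distrib n f g =
    solve 4 (λ a b c d → (a :+ b) :+ (c :+ d) := (a :+ c) :+ (b :+ d)) refl (sumTo n f) (sumTo n g) (f (suc n)) (g (suc n))

  sumTo-*ˡ : ∀ n c f → c * sumTo n f ≡ sumTo n (λ i → c * f i)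
  sumTo-*ˡ zero c f = refl
  sumTo-*ˡ (suc n) c f = trans (ℤ.*-distribˡ-+ c (sumTo n f) (f (suc n))) (cong (_+ c * f (suc n)) (sumTo-*ˡ n c f))

  sumTo-comm : ∀ a b (f : ℕ → ℕ → ℤ) → sumTo a (λ i → sumTo b (f i)) ≡ sumTo b (λ j → sumTo a (λ i → f i j))
  sumTo-comm zero b f = refl
  sumTo-comm (suc a) b f rewrite sumTo-comm a b f = sym (sumTo-distrib b (λ j → sumTo a (λ i → f i j)) (f (suc a)))

  sumTo-zero : ∀ n f → (∀ i → i ≤ n → f i ≡ + 0) → sumTo n f ≡ + 0
  sumTo-zero n f h = trans (sumTo-cong n f (λ _ → + 0) h) (zeros n)
    where
    zeros : ∀ n → sumTo n (λ _ → + 0) ≡ + 0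
    zeros zero = refl
    zeros (suc n) = cong (_+ + 0) (zeros n)

  sumTo-suc : ∀ n f → sumTo (suc n) f ≡ f 0 + sumTo n (λ i → f (suc i))
  sumTo-suc zero f = refl
  sumTo-suc (suc n) f rewrite sumTo-suc n f = ℤ.+-assoc (f 0) _ _

  sumTo-last : ∀ n f → (∀ i → i < n → f i ≡ + 0) → sumTo n f ≡ f n
  sumTo-last zero f h = refl
  sumTo-last (suc n) f h = trans (cong (_+ f (suc n)) (sumTo-zero n f (λ i i≤n → h i (s≤s i≤n)))) (ℤ.+-identityˡ _)

  sumTo-truncate : ∀ n t f → t ≤ n → (∀ i → t < i → i ≤ n → f i ≡ + 0) → sumTo n f ≡ sumTo t f
  sumTo-truncate zero zero f t≤n h = refl
  sumTo-truncate (suc n) t f t≤n h with ℕ.m≤n⇒m<n∨m≡n t≤n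
  ... | inj₂ refl = refl
  ... | inj₁ (s≤s t≤n′) = trans (cong (λ z → sumTo n f + z) (h (suc n) (s≤s t≤n′) ℕ.≤-refl))
      (trans (ℤ.+-identityʳ _) (sumTo-truncate n t f t≤n′ (λ i t<i i≤n → h i t<i (ℕ.m≤n⇒m≤1+n i≤n))))

  sumTo-dropZeros : ∀ a k f → (∀ i → i < a → f i ≡ + 0) → sumTo (a ℕ.+ k) f ≡ sumTo k (λ i → f (a ℕ.+ i))
  sumTo-dropZeros a zero f h = trans (cong (λ z → sumTo z f) (ℕ.+-identityʳ a))
    (trans (sumTo-last a f h) (cong f (sym (ℕ.+-identityʳ a))))
  sumTo-dropZeros a (suc k) f h = trans (cong (λ z → sumTo z f) (ℕ.+-suc a k))
    (trans (cong (_+ f (suc (a ℕ.+ k))) (sumTo-dropZeros a k f h))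
           (cong (λ z → sumTo k (λ i → f (a ℕ.+ i)) + f z) (sym (ℕ.+-suc a k))))

  sumToℕ : ℕ → (ℕ → ℕ) → ℕ
  sumToℕ zero f = f zero
  sumToℕ (suc n) f = sumToℕ n f ℕ.+ f (suc n)

  sumTo-+ : ∀ n f → sumTo n (λ i → + f i) ≡ + sumToℕ n f
  sumTo-+ zero f = refl
  sumTo-+ (suc n) f = trans (cong (_+ + f (suc n)) (sumTo-+ n f)) (sym (ℤ.pos-+ (sumToℕ n f) (f (suc n))))

  sumToℕ-cong : ∀ n f g → (∀ i → i ≤ n → f i ≡ g i) → sumToℕ n f ≡ sumToℕ n g
  sumToℕ-cong zero f g h = h 0 z≤n
  sumToℕ-cong (suc n) f g h = cong₂ ℕ._+_ (sumToℕ-cong n f g (λ i i≤n → h i (ℕ.m≤n⇒m≤1+n i≤n))) (h (suc n) ℕ.≤-refl)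

  sumToℕ-distrib : ∀ n f g → sumToℕ n (λ i → f i ℕ.+ g i) ≡ sumToℕ n f ℕ.+ sumToℕ n g
  sumToℕ-distrib zero f g = refl
  sumToℕ-distrib (suc n) f g rewrite sumToℕ-distrib n f g = +-interchange (sumToℕ n f) (sumToℕ n g) (f (suc n)) (g (suc n))

  sumToℕ-zero : ∀ n f → (∀ i → i ≤ n → f i ≡ 0) → sumToℕ n f ≡ 0
  sumToℕ-zero zero f h = h 0 z≤n
  sumToℕ-zero (suc n) f h = cong₂ ℕ._+_ (sumToℕ-zero n f (λ i i≤n → h i (ℕ.m≤n⇒m≤1+n i≤n))) (h (suc n) ℕ.≤-refl)

  sumToℕ-*ˡ : ∀ n c f → c ℕ.* sumToℕ n f ≡ sumToℕ n (λ i → c ℕ.* f i)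
  sumToℕ-*ˡ zero c f = refl
  sumToℕ-*ˡ (suc n) c f = trans (ℕ.*-distribˡ-+ c (sumToℕ n f) (f (suc n))) (cong (ℕ._+ c ℕ.* f (suc n)) (sumToℕ-*ˡ n c f))

  sumToℕ-suc : ∀ n f → sumToℕ (suc n) f ≡ f 0 ℕ.+ sumToℕ n (λ i → f (suc i))
  sumToℕ-suc zero f = refl
  sumToℕ-suc (suc n) f rewrite sumToℕ-suc n f = ℕ.+-assoc (f 0) _ _

  sumToℕ-reverse : ∀ n f → sumToℕ n (λ i → f (n ∸ i)) ≡ sumToℕ n f
  sumToℕ-reverse zero f = refl
  sumToℕ-reverse (suc n) f = trans (sumToℕ-suc n (λ i → f (suc n ∸ i)))
    (trans (cong (f (suc n) ℕ.+_) (sumToℕ-reverse n f)) (ℕ.+-comm (f (suc n)) (sumToℕ n f)))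

  pascal : ∀ n k → suc n C suc k ≡ n C k ℕ.+ n C suc k
  pascal n k = sym (nCk+nC[k+1]≡[n+1]C[k+1] n k)

  absorption : ∀ r m → suc m ℕ.* (suc r C suc m) ≡ suc r ℕ.* (r C m)
  absorption zero zero = refl
  absorption zero (suc m) = ℕ.*-zeroʳ (suc (suc m))
  absorption (suc r) zero = trans (ℕ.*-identityˡ _) (trans (nC1≡n (suc (suc r))) (sym (ℕ.*-identityʳ _)))
  absorption (suc r) (suc m) = begin
    suc (suc m) ℕ.* (suc (suc r) C suc (suc m))
      ≡⟨ cong (suc (suc m) ℕ.*_) (pascal (suc r) (suc m)) ⟩
    suc (suc m) ℕ.* (suc r C suc m ℕ.+ suc r C suc (suc m))
      ≡⟨ ℕ.*-distribˡ-+ (suc (suc m)) (suc r C suc m) (suc r C suc (suc m)) ⟩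
    suc r C suc m ℕ.+ suc m ℕ.* (suc r C suc m) ℕ.+ suc (suc m) ℕ.* (suc r C suc (suc m))
      ≡⟨ cong₂ (λ u v → suc r C suc m ℕ.+ u ℕ.+ v) (absorption r m) (absorption r (suc m)) ⟩
    suc r C suc m ℕ.+ suc r ℕ.* (r C m) ℕ.+ suc r ℕ.* (r C suc m)
      ≡⟨ ℕ.+-assoc (suc r C suc m) _ _ ⟩
    suc r C suc m ℕ.+ (suc r ℕ.* (r C m) ℕ.+ suc r ℕ.* (r C suc m))
      ≡⟨ cong (suc r C suc m ℕ.+_) (sym (trans (cong (suc r ℕ.*_) (pascal r m)) (ℕ.*-distribˡ-+ (suc r) (r C m) (r C suc m)))) ⟩
    suc (suc r) ℕ.* (suc r C suc m) ∎
    where open ≡-Reasoning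

  vandermonde : ∀ i k m → sumToℕ m (λ l → (i C l) ℕ.* (k C (m ∸ l))) ≡ (i ℕ.+ k) C m
  vandermonde zero k m = trans (sumToℕ-cong m _ onlyFirst (λ l _ → first l)) (sumOnlyFirst m)
    where
    onlyFirst : ℕ → ℕ
    onlyFirst zero = k C m
    onlyFirst (suc _) = 0
    first : ∀ l → (0 C l) ℕ.* (k C (m ∸ l)) ≡ onlyFirst l
    first zero = ℕ.+-identityʳ _
    first (suc l) = refl
    sumOnlyFirst : ∀ m′ → sumToℕ m′ onlyFirst ≡ k C m
    sumOnlyFirst zero = refl
    sumOnlyFirst (suc m′) = trans (ℕ.+-identityʳ _) (sumOnlyFirst m′)
  vandermonde (suc i) k zero = refl
  vandermonde (suc i) k (suc m) = begin
    sumToℕ (suc m) (λ l → (suc i C l) ℕ.* (k C (suc m ∸ l)))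
      ≡⟨ sumToℕ-suc m _ ⟩
    1 ℕ.* (k C suc m) ℕ.+ sumToℕ m (λ l → (suc i C suc l) ℕ.* (k C (m ∸ l)))
      ≡⟨ cong (1 ℕ.* (k C suc m) ℕ.+_) (trans (sumToℕ-cong m _ _ (λ l _ → trans (cong (ℕ._* (k C (m ∸ l))) (pascal i l))
                                                                        (ℕ.*-distribʳ-+ (k C (m ∸ l)) (i C l) (i C suc l))))
                                                (sumToℕ-distrib m _ _)) ⟩
    1 ℕ.* (k C suc m) ℕ.+ (sumToℕ m (λ l → (i C l) ℕ.* (k C (m ∸ l))) ℕ.+ sumToℕ m (λ l → (i C suc l) ℕ.* (k C (m ∸ l))))
      ≡⟨ x∙yz≈y∙xz (1 ℕ.* (k C suc m)) (sumToℕ m (λ l → (i C l) ℕ.* (k C (m ∸ l)))) _ ⟩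
    sumToℕ m (λ l → (i C l) ℕ.* (k C (m ∸ l))) ℕ.+ (1 ℕ.* (k C suc m) ℕ.+ sumToℕ m (λ l → (i C suc l) ℕ.* (k C (m ∸ l))))
      ≡⟨ cong₂ ℕ._+_ (vandermonde i k m) (sym (sumToℕ-suc m (λ l → (i C l) ℕ.* (k C (suc m ∸ l))))) ⟩
    (i ℕ.+ k) C m ℕ.+ sumToℕ (suc m) (λ l → (i C l) ℕ.* (k C (suc m ∸ l)))
      ≡⟨ cong ((i ℕ.+ k) C m ℕ.+_) (vandermonde i k (suc m)) ⟩
    (i ℕ.+ k) C m ℕ.+ (i ℕ.+ k) C suc m
      ≡⟨ sym (pascal (i ℕ.+ k) m) ⟩
    (suc i ℕ.+ k) C suc m ∎
    where open ≡-Reasoning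

  multichoose : ℕ → ℕ → ℕ
  multichoose s a = (s ℕ.+ a) C a

  multichoose-zeroˡ : ∀ a → multichoose 0 a ≡ 1
  multichoose-zeroˡ a = nCn≡1 a

  multichoose-pascal : ∀ s a → multichoose (suc s) (suc a) ≡ multichoose (suc s) a ℕ.+ multichoose s (suc a)
  multichoose-pascal s a = trans (pascal (s ℕ.+ suc a) a) (cong (λ z → z C a ℕ.+ multichoose s (suc a)) (ℕ.+-suc s a))

  hockey-stick : ∀ s n → sumToℕ n (multichoose s) ≡ multichoose (suc s) n
  hockey-stick s zero = refl
  hockey-stick s (suc n) = trans (cong (ℕ._+ multichoose s (suc n)) (hockey-stick s n)) (sym (multichoose-pascal s n))

  multichoose-convolution : ∀ p q n → sumToℕ n (λ i → multichoose p i ℕ.* multichoose q (n ∸ i)) ≡ multichoose (suc (p ℕ.+ q)) n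
  multichoose-convolution zero q n =
    trans (sumToℕ-cong n _ (λ i → multichoose q (n ∸ i))
            (λ i _ → trans (cong (ℕ._* multichoose q (n ∸ i)) (multichoose-zeroˡ i)) (ℕ.*-identityˡ _)))
          (trans (sumToℕ-reverse n (multichoose q)) (hockey-stick q n))
  multichoose-convolution (suc p) q zero = refl
  multichoose-convolution (suc p) q (suc n) = begin
    sumToℕ (suc n) (λ i → multichoose (suc p) i ℕ.* multichoose q (suc n ∸ i))
      ≡⟨ sumToℕ-suc n _ ⟩
    1 ℕ.* multichoose q (suc n) ℕ.+ sumToℕ n (λ i → multichoose (suc p) (suc i) ℕ.* multichoose q (n ∸ i))
      ≡⟨ cong (1 ℕ.* multichoose q (suc n) ℕ.+_)
              (trans (sumToℕ-cong n _ _ (λ i _ → trans (cong (ℕ._* multichoose q (n ∸ i)) (multichoose-pascal p i))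
                                                        (ℕ.*-distribʳ-+ (multichoose q (n ∸ i)) (multichoose (suc p) i) (multichoose p (suc i)))))
                     (sumToℕ-distrib n _ _)) ⟩
    1 ℕ.* multichoose q (suc n) ℕ.+ (Σ[p+1] ℕ.+ sumToℕ n (λ i → multichoose p (suc i) ℕ.* multichoose q (n ∸ i)))
      ≡⟨ x∙yz≈y∙xz (1 ℕ.* multichoose q (suc n)) Σ[p+1] (sumToℕ n (λ i → multichoose p (suc i) ℕ.* multichoose q (n ∸ i))) ⟩
    Σ[p+1] ℕ.+ (1 ℕ.* multichoose q (suc n) ℕ.+ sumToℕ n (λ i → multichoose p (suc i) ℕ.* multichoose q (n ∸ i)))
      ≡⟨ cong₂ ℕ._+_ (multichoose-convolution (suc p) q n) (sym (sumToℕ-suc n (λ i → multichoose p i ℕ.* multichoose q (suc n ∸ i)))) ⟩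
    multichoose (suc (suc p ℕ.+ q)) n ℕ.+ sumToℕ (suc n) (λ i → multichoose p i ℕ.* multichoose q (suc n ∸ i))
      ≡⟨ cong (multichoose (suc (suc p ℕ.+ q)) n ℕ.+_) (multichoose-convolution p q (suc n)) ⟩
    multichoose (suc (suc p ℕ.+ q)) n ℕ.+ multichoose (suc (p ℕ.+ q)) (suc n)
      ≡⟨ sym (multichoose-pascal (suc (p ℕ.+ q)) n) ⟩
    multichoose (suc (suc p ℕ.+ q)) (suc n) ∎
    where
    open ≡-Reasoning
    Σ[p+1] = sumToℕ n (λ i → multichoose (suc p) i ℕ.* multichoose q (n ∸ i))


module Series where

  open import Data.Nat as ℕ using (ℕ; zero; suc; _≤_; _<_; s≤s; z≤n; _∸_)
  import Data.Nat.Properties as ℕ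
  open import Data.Integer as ℤ using (+_; _*_)
  import Data.Integer.Properties as ℤ
  open import Relation.Binary.PropositionalEquality
  open import Relation.Nullary using (yes; no)
  open import Defs
  open Sums

  ≈₂-trans : ∀ {a b c} → a ≈₂ b → b ≈₂ c → a ≈₂ c
  ≈₂-trans a≈b b≈c n m = trans (a≈b n m) (b≈c n m)

  *₂-cong : ∀ {a a′ b b′} → a ≈₂ a′ → b ≈₂ b′ → (a *₂ b) ≈₂ (a′ *₂ b′)
  *₂-cong a≈a′ b≈b′ n m =
    sumTo-cong n _ _ (λ i _ → sumTo-cong m _ _ (λ l _ → cong₂ _*_ (a≈a′ i l) (b≈b′ (n ∸ i) (m ∸ l))))

  shiftX : ℕ → Series2 → Series2
  shiftX zero S n m = S n m
  shiftX (suc b) S zero m = + 0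
  shiftX (suc b) S (suc n) m = shiftX b S n m

  shiftX-+ : ∀ b S t m → shiftX b S (b ℕ.+ t) m ≡ S t m
  shiftX-+ zero S t m = refl
  shiftX-+ (suc b) S t m = shiftX-+ b S t m

  shiftX-< : ∀ b S n m → n < b → shiftX b S n m ≡ + 0
  shiftX-< (suc b) S zero m _ = refl
  shiftX-< (suc b) S (suc n) m (s≤s n<b) = shiftX-< b S n m n<b

  shiftX-cong : ∀ b {S S′} → S ≈₂ S′ → shiftX b S ≈₂ shiftX b S′
  shiftX-cong zero S≈S′ n m = S≈S′ n m
  shiftX-cong (suc b) S≈S′ zero m = refl
  shiftX-cong (suc b) S≈S′ (suc n) m = shiftX-cong b S≈S′ n m

  shiftX-shiftX : ∀ a b S → shiftX a (shiftX b S) ≈₂ shiftX (a ℕ.+ b) S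
  shiftX-shiftX zero b S n m = refl
  shiftX-shiftX (suc a) b S zero m = refl
  shiftX-shiftX (suc a) b S (suc n) m = shiftX-shiftX a b S n m

  private
    data Split (b n : ℕ) : Set where
      below : n < b → Split b n
      above : ∀ t → n ≡ b ℕ.+ t → Split b n

    split : ∀ b n → Split b n
    split b n with n ℕ.<? b
    ... | yes n<b = below n<b
    ... | no n≮b = above (n ∸ b) (sym (ℕ.m+[n∸m]≡n (ℕ.≮⇒≥ n≮b)))

  *₂-shiftXʳ : ∀ b A B → (A *₂ shiftX b B) ≈₂ shiftX b (A *₂ B)
  *₂-shiftXʳ b A B n m with split b n
  ... | below n<b =
    trans (sumTo-zero n _ (λ i _ → sumTo-zero m _ (λ l _ →
            trans (cong (A i l *_) (shiftX-< b B (n ∸ i) (m ∸ l) (ℕ.≤-<-trans (ℕ.m∸n≤m n i) n<b))) (ℤ.*-zeroʳ (A i l)))))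
          (sym (shiftX-< b (A *₂ B) n m n<b))
  ... | above t refl =
    trans (sumTo-truncate (b ℕ.+ t) t _ (ℕ.m≤n+m t b) vanishing)
          (trans (sumTo-cong t _ _ (λ i i≤t → sumTo-cong m _ _ (λ l _ → cong (A i l *_)
                   (trans (cong (λ z → shiftX b B z (m ∸ l)) (ℕ.+-∸-assoc b i≤t)) (shiftX-+ b B (t ∸ i) (m ∸ l))))))
                 (sym (shiftX-+ b (A *₂ B) t m)))
    where
    vanishing : ∀ i → t < i → i ≤ b ℕ.+ t → sumTo m (λ l → A i l * shiftX b B (b ℕ.+ t ∸ i) (m ∸ l)) ≡ + 0
    vanishing i t<i i≤b+t = sumTo-zero m _ (λ l _ →
      trans (cong (A i l *_) (shiftX-< b B (b ℕ.+ t ∸ i) (m ∸ l) b+t∸i<b)) (ℤ.*-zeroʳ (A i l)))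
      where
      b+t∸i<b : b ℕ.+ t ∸ i < b
      b+t∸i<b = ℕ.+-cancelʳ-< i (b ℕ.+ t ∸ i) b
                  (ℕ.≤-<-trans (ℕ.≤-reflexive (ℕ.m∸n+n≡m i≤b+t)) (ℕ.+-monoʳ-< b t<i))

  *₂-shiftXˡ : ∀ a A B → (shiftX a A *₂ B) ≈₂ shiftX a (A *₂ B)
  *₂-shiftXˡ a A B n m with split a n
  ... | below n<a =
    trans (sumTo-zero n _ (λ i i≤n → sumTo-zero m _ (λ l _ →
            trans (cong (_* B (n ∸ i) (m ∸ l)) (shiftX-< a A i l (ℕ.≤-<-trans i≤n n<a))) (ℤ.*-zeroˡ (B (n ∸ i) (m ∸ l))))))
          (sym (shiftX-< a (A *₂ B) n m n<a))
  ... | above t refl =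
    trans (sumTo-dropZeros a t _ (λ i i<a → sumTo-zero m _ (λ l _ →
            trans (cong (_* B (a ℕ.+ t ∸ i) (m ∸ l)) (shiftX-< a A i l i<a)) (ℤ.*-zeroˡ (B (a ℕ.+ t ∸ i) (m ∸ l))))))
          (trans (sumTo-cong t _ _ (λ i _ → sumTo-cong m _ _ (λ l _ →
                   cong₂ _*_ (shiftX-+ a A i l) (cong (λ z → B z (m ∸ l)) (ℕ.[m+n]∸[m+o]≡n∸o a t i)))))
                 (sym (shiftX-+ a (A *₂ B) t m)))

  *₂-identityˡ : ∀ S → (one₂ *₂ S) ≈₂ S
  *₂-identityˡ S n m =
    trans (sumTo-truncate n 0 _ z≤n (λ i 0<i _ → sumTo-zero m _ (λ l _ → higher i l 0<i)))
          (trans (sumTo-truncate m 0 _ z≤n (λ l 0<l _ → right l 0<l)) (ℤ.*-identityˡ (S n m)))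
    where
    higher : ∀ i l → 0 < i → one₂ i l * S (n ∸ i) (m ∸ l) ≡ + 0
    higher (suc i) zero _ = refl
    higher (suc i) (suc l) _ = refl
    right : ∀ l → 0 < l → one₂ 0 l * S n (m ∸ l) ≡ + 0
    right (suc l) _ = refl

  *₂-identityʳ : ∀ S → (S *₂ one₂) ≈₂ S
  *₂-identityʳ S n m =
    trans (sumTo-last n _ (λ i i<n → sumTo-zero m _ (λ l _ →
            trans (cong (S i l *_) (one₂-suc (n ∸ i) (m ∸ l) (ℕ.m<n⇒0<n∸m i<n))) (ℤ.*-zeroʳ (S i l)))))
    (trans (sumTo-last m _ (λ l l<m →
              trans (cong (S n l *_) (one₂-sucʳ (n ∸ n) (m ∸ l) (ℕ.m<n⇒0<n∸m l<m))) (ℤ.*-zeroʳ (S n l))))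
           (trans (cong₂ (λ a b → S n m * one₂ a b) (ℕ.n∸n≡0 n) (ℕ.n∸n≡0 m)) (ℤ.*-identityʳ (S n m))))
    where
    one₂-suc : ∀ a b → 0 < a → one₂ a b ≡ + 0
    one₂-suc (suc a) zero _ = refl
    one₂-suc (suc a) (suc b) _ = refl
    one₂-sucʳ : ∀ a b → 0 < b → one₂ a b ≡ + 0
    one₂-sucʳ zero (suc b) _ = refl
    one₂-sucʳ (suc a) (suc b) _ = refl

  X₂≈shiftX-one₂ : X₂ ≈₂ shiftX 1 one₂
  X₂≈shiftX-one₂ zero m = refl
  X₂≈shiftX-one₂ (suc zero) zero = refl
  X₂≈shiftX-one₂ (suc zero) (suc m) = refl
  X₂≈shiftX-one₂ (suc (suc n)) zero = refl
  X₂≈shiftX-one₂ (suc (suc n)) (suc m) = refl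


module InverseOfD where

  open import Data.Nat as ℕ using (ℕ; zero; suc; _≤_; _<_; s≤s; z≤n; _∸_)
  import Data.Nat.Properties as ℕ
  open import Data.Nat.Combinatorics using (_C_; nCn≡1)
  open import Data.Integer as ℤ using (ℤ; +_; -_; _+_; _*_; _-_)
  import Data.Integer.Properties as ℤ
  open import Relation.Binary.PropositionalEquality
  open import Data.Integer.Solver using (module +-*-Solver)
  open +-*-Solver
  open import Defs
  open Sums
  open import Algebra.Properties.CommutativeSemigroup ℕ.+-commutativeSemigroup
    using () renaming (interchange to +-interchange)

  −1^ : ℕ → ℤ
  −1^ zero = + 1
  −1^ (suc n) = - −1^ n

  −1^-+ : ∀ a b → −1^ (a ℕ.+ b) ≡ −1^ a * −1^ b
  −1^-+ zero b = sym (ℤ.*-identityˡ (−1^ b))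
  −1^-+ (suc a) b = trans (cong -_ (−1^-+ a b)) (ℤ.neg-distribˡ-* (−1^ a) (−1^ b))

  -- the coefficients of (1 + x - xy)^-(s+1): the x^a y^b one is (−1)^(a+b) C(s+a,a) C(a,b)
  Dinv : ℕ → Series2
  Dinv s a b = −1^ (a ℕ.+ b) * + (multichoose s a ℕ.* (a C b))

  private
    sumTo-*-+ : ∀ n c f → sumTo n (λ i → c * + f i) ≡ c * + sumToℕ n f
    sumTo-*-+ n c f = trans (sym (sumTo-*ˡ n c (λ i → + f i))) (cong (c *_) (sumTo-+ n f))

    +-∸-split : ∀ n m i l → i ≤ n → l ≤ m → (i ℕ.+ l) ℕ.+ ((n ∸ i) ℕ.+ (m ∸ l)) ≡ n ℕ.+ m
    +-∸-split n m i l i≤n l≤m = begin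
      (i ℕ.+ l) ℕ.+ ((n ∸ i) ℕ.+ (m ∸ l))  ≡⟨ +-interchange i l (n ∸ i) (m ∸ l) ⟩
      (i ℕ.+ (n ∸ i)) ℕ.+ (l ℕ.+ (m ∸ l))  ≡⟨ cong₂ ℕ._+_ (ℕ.m+[n∸m]≡n i≤n) (ℕ.m+[n∸m]≡n l≤m) ⟩
      n ℕ.+ m                              ∎
      where open ≡-Reasoning

    Dinv-*-term : ∀ p q n m i l → i ≤ n → l ≤ m → Dinv p i l * Dinv q (n ∸ i) (m ∸ l)
      ≡ −1^ (n ℕ.+ m) * + ((multichoose p i ℕ.* multichoose q (n ∸ i)) ℕ.* ((i C l) ℕ.* ((n ∸ i) C (m ∸ l))))
    Dinv-*-term p q n m i l i≤n l≤m = begin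
      −1^ (i ℕ.+ l) * + (multichoose p i ℕ.* (i C l)) * (−1^ ((n ∸ i) ℕ.+ (m ∸ l)) * + (multichoose q (n ∸ i) ℕ.* ((n ∸ i) C (m ∸ l))))
        ≡⟨ cong₂ (λ u v → −1^ (i ℕ.+ l) * u * (−1^ ((n ∸ i) ℕ.+ (m ∸ l)) * v))
                 (ℤ.pos-* (multichoose p i) (i C l)) (ℤ.pos-* (multichoose q (n ∸ i)) ((n ∸ i) C (m ∸ l))) ⟩
      −1^ (i ℕ.+ l) * (+ multichoose p i * + (i C l)) * (−1^ ((n ∸ i) ℕ.+ (m ∸ l)) * (+ multichoose q (n ∸ i) * + ((n ∸ i) C (m ∸ l))))
        ≡⟨ solve 6 (λ s₁ a b s₂ c d → s₁ :* (a :* b) :* (s₂ :* (c :* d)) := (s₁ :* s₂) :* ((a :* c) :* (b :* d))) refl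
             (−1^ (i ℕ.+ l)) (+ multichoose p i) (+ (i C l)) (−1^ ((n ∸ i) ℕ.+ (m ∸ l))) (+ multichoose q (n ∸ i)) (+ ((n ∸ i) C (m ∸ l))) ⟩
      (−1^ (i ℕ.+ l) * −1^ ((n ∸ i) ℕ.+ (m ∸ l))) * ((+ multichoose p i * + multichoose q (n ∸ i)) * (+ (i C l) * + ((n ∸ i) C (m ∸ l))))
        ≡⟨ cong₂ _*_ (trans (sym (−1^-+ (i ℕ.+ l) _)) (cong −1^ (+-∸-split n m i l i≤n l≤m)))
                     (trans (cong₂ _*_ (sym (ℤ.pos-* (multichoose p i) (multichoose q (n ∸ i)))) (sym (ℤ.pos-* (i C l) ((n ∸ i) C (m ∸ l)))))
                            (sym (ℤ.pos-* (multichoose p i ℕ.* multichoose q (n ∸ i)) ((i C l) ℕ.* ((n ∸ i) C (m ∸ l)))))) ⟩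
      −1^ (n ℕ.+ m) * + ((multichoose p i ℕ.* multichoose q (n ∸ i)) ℕ.* ((i C l) ℕ.* ((n ∸ i) C (m ∸ l)))) ∎
      where open ≡-Reasoning

  -- The x-part multiplies as multisets (a convolution of multichoose) and the y-part by Vandermonde.
  Dinv-*₂ : ∀ p q → (Dinv p *₂ Dinv q) ≈₂ Dinv (suc (p ℕ.+ q))
  Dinv-*₂ p q n m = begin
    sumTo n (λ i → sumTo m (λ l → Dinv p i l * Dinv q (n ∸ i) (m ∸ l)))
      ≡⟨ sumTo-cong n _ _ (λ i i≤n → trans (sumTo-cong m _ _ (λ l l≤m → Dinv-*-term p q n m i l i≤n l≤m))
                                           (sumTo-*-+ m (−1^ (n ℕ.+ m)) _)) ⟩
    sumTo n (λ i → −1^ (n ℕ.+ m) * + sumToℕ m (λ l → X i ℕ.* Y i l))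
      ≡⟨ sumTo-cong n _ _ (λ i i≤n → cong (λ z → −1^ (n ℕ.+ m) * + z)
           (trans (sym (sumToℕ-*ˡ m (X i) (Y i))) (cong (X i ℕ.*_) (trans (vandermonde i (n ∸ i) m)
                                                                      (cong (_C m) (ℕ.m+[n∸m]≡n i≤n)))))) ⟩
    sumTo n (λ i → −1^ (n ℕ.+ m) * + (X i ℕ.* (n C m)))
      ≡⟨ sumTo-*-+ n (−1^ (n ℕ.+ m)) _ ⟩
    −1^ (n ℕ.+ m) * + sumToℕ n (λ i → X i ℕ.* (n C m))
      ≡⟨ cong (λ z → −1^ (n ℕ.+ m) * + z)
              (trans (sumToℕ-cong n _ _ (λ i _ → ℕ.*-comm (X i) (n C m)))
              (trans (sym (sumToℕ-*ˡ n (n C m) X))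
              (trans (ℕ.*-comm (n C m) _) (cong (ℕ._* (n C m)) (multichoose-convolution p q n))))) ⟩
    −1^ (n ℕ.+ m) * + (multichoose (suc (p ℕ.+ q)) n ℕ.* (n C m)) ∎
    where
    open ≡-Reasoning
    X : ℕ → ℕ
    X i = multichoose p i ℕ.* multichoose q (n ∸ i)
    Y : ℕ → ℕ → ℕ
    Y i l = (i C l) ℕ.* ((n ∸ i) C (m ∸ l))

  private
    D₂-≥2 : ∀ a b → 2 ≤ a → D₂ a b ≡ + 0
    D₂-≥2 (suc (suc a)) zero _ = refl
    D₂-≥2 (suc (suc a)) (suc b) _ = refl
    D₂-≥2 (suc zero) _ (s≤s ())

    D₂-1-≥2 : ∀ b → 2 ≤ b → D₂ 1 b ≡ + 0
    D₂-1-≥2 (suc (suc b)) _ = refl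
    D₂-1-≥2 (suc zero) (s≤s ())

    D₂-0-≥1 : ∀ b → 1 ≤ b → D₂ 0 b ≡ + 0
    D₂-0-≥1 (suc b) _ = refl

    2≤suc-n∸i : ∀ n i → i < n → 2 ≤ suc n ∸ i
    2≤suc-n∸i (suc n) zero _ = s≤s (s≤s z≤n)
    2≤suc-n∸i (suc n) (suc i) (s≤s i<n) = 2≤suc-n∸i n i i<n

    suc-n∸n≡1 : ∀ n → suc n ∸ n ≡ 1
    suc-n∸n≡1 zero = refl
    suc-n∸n≡1 (suc n) = suc-n∸n≡1 n

    lastRow : ∀ (w : Series2) n m → sumTo m (λ l → w n l * D₂ (n ∸ n) (m ∸ l)) ≡ w n m
    lastRow w n m =
      trans (sumTo-last m _ (λ l l<m → trans (cong (λ z → w n l * D₂ z (m ∸ l)) (ℕ.n∸n≡0 n))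
                                       (trans (cong (w n l *_) (D₂-0-≥1 (m ∸ l) (ℕ.m<n⇒0<n∸m l<m))) (ℤ.*-zeroʳ (w n l)))))
            (trans (cong₂ (λ a b → w n m * D₂ a b) (ℕ.n∸n≡0 n) (ℕ.n∸n≡0 m)) (ℤ.*-identityʳ (w n m)))

    previousRow : ∀ (w : Series2) n m → sumTo n (λ i → sumTo m (λ l → w i l * D₂ (suc n ∸ i) (m ∸ l)))
                                       ≡ sumTo m (λ l → w n l * D₂ 1 (m ∸ l))
    previousRow w n m =
      trans (sumTo-last n _ (λ i i<n → sumTo-zero m _ (λ l _ →
              trans (cong (w i l *_) (D₂-≥2 (suc n ∸ i) (m ∸ l) (2≤suc-n∸i n i i<n))) (ℤ.*-zeroʳ (w i l)))))
            (sumTo-cong m _ _ (λ l _ → cong (λ z → w n l * D₂ z (m ∸ l)) (suc-n∸n≡1 n)))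

  *₂-D₂-zero : ∀ (w : Series2) m → (w *₂ D₂) 0 m ≡ w 0 m
  *₂-D₂-zero w m = lastRow w 0 m

  *₂-D₂-suc-zero : ∀ (w : Series2) n → (w *₂ D₂) (suc n) 0 ≡ w n 0 + w (suc n) 0
  *₂-D₂-suc-zero w n = cong₂ _+_ (trans (previousRow w n 0) (ℤ.*-identityʳ (w n 0))) (lastRow w (suc n) 0)

  *₂-D₂-suc-suc : ∀ (w : Series2) n m → (w *₂ D₂) (suc n) (suc m) ≡ (w n (suc m) - w n m) + w (suc n) (suc m)
  *₂-D₂-suc-suc w n m = cong₂ _+_ (trans (previousRow w n (suc m)) middle) (lastRow w (suc n) (suc m))
    where
    open ≡-Reasoning
    middle : sumTo (suc m) (λ l → w n l * D₂ 1 (suc m ∸ l)) ≡ w n (suc m) - w n m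
    middle = begin
      sumTo m (λ l → w n l * D₂ 1 (suc m ∸ l)) + w n (suc m) * D₂ 1 (m ∸ m)
        ≡⟨ cong₂ _+_ (sumTo-last m _ (λ l l<m → trans (cong (w n l *_) (D₂-1-≥2 (suc m ∸ l) (2≤suc-n∸i m l l<m))) (ℤ.*-zeroʳ (w n l))))
                     (trans (cong (λ z → w n (suc m) * D₂ 1 z) (ℕ.n∸n≡0 m)) (ℤ.*-identityʳ (w n (suc m)))) ⟩
      w n m * D₂ 1 (suc m ∸ m) + w n (suc m)
        ≡⟨ cong (λ z → w n m * D₂ 1 z + w n (suc m)) (suc-n∸n≡1 m) ⟩
      w n m * - (+ 1) + w n (suc m)
        ≡⟨ solve 2 (λ a b → a :* (:- con (+ 1)) :+ b := b :- a) refl (w n m) (w n (suc m)) ⟩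
      w n (suc m) - w n m ∎

  Dinv-zero : ∀ n m → Dinv 0 n m ≡ −1^ (n ℕ.+ m) * + (n C m)
  Dinv-zero n m = cong (λ z → −1^ (n ℕ.+ m) * + z) (trans (cong (ℕ._* (n C m)) (nCn≡1 n)) (ℕ.*-identityˡ (n C m)))

  -- (1 + x - xy) w = 1 determines w row by row
  inverse-of-D₂ : ∀ (w : Series2) → (w *₂ D₂) ≈₂ one₂ → w ≈₂ Dinv 0
  inverse-of-D₂ w wD≈1 zero zero = trans (sym (*₂-D₂-zero w 0)) (trans (wD≈1 0 0) (sym (Dinv-zero 0 0)))
  inverse-of-D₂ w wD≈1 zero (suc m) =
    trans (sym (*₂-D₂-zero w (suc m))) (trans (wD≈1 0 (suc m)) (sym (trans (Dinv-zero 0 (suc m)) (ℤ.*-zeroʳ (−1^ (suc m))))))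
  inverse-of-D₂ w wD≈1 (suc n) zero = begin
    w (suc n) 0                        ≡⟨ solve 2 (λ a b → b := (a :+ b) :- a) refl (w n 0) (w (suc n) 0) ⟩
    (w n 0 + w (suc n) 0) - w n 0      ≡⟨ cong₂ _-_ (trans (sym (*₂-D₂-suc-zero w n)) (wD≈1 (suc n) 0))
                                                    (trans (inverse-of-D₂ w wD≈1 n 0) (Dinv-zero n 0)) ⟩
    + 0 - −1^ (n ℕ.+ 0) * + 1          ≡⟨ solve 1 (λ s → con (+ 0) :- s :* con (+ 1) := (:- s) :* con (+ 1)) refl (−1^ (n ℕ.+ 0)) ⟩
    −1^ (suc n ℕ.+ 0) * + (suc n C 0)   ≡⟨ sym (Dinv-zero (suc n) 0) ⟩
    Dinv 0 (suc n) 0                   ∎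
    where open ≡-Reasoning
  inverse-of-D₂ w wD≈1 (suc n) (suc m) = begin
    w (suc n) (suc m)
      ≡⟨ solve 3 (λ a b c → c := ((a :- b) :+ c) :- a :+ b) refl (w n (suc m)) (w n m) (w (suc n) (suc m)) ⟩
    ((w n (suc m) - w n m) + w (suc n) (suc m)) - w n (suc m) + w n m
      ≡⟨ cong₂ (λ a b → a - b + w n m) (trans (sym (*₂-D₂-suc-suc w n m)) (wD≈1 (suc n) (suc m)))
                                      (trans (inverse-of-D₂ w wD≈1 n (suc m)) (Dinv-zero n (suc m))) ⟩
    + 0 - −1^ (n ℕ.+ suc m) * + (n C suc m) + w n m
      ≡⟨ cong₂ (λ a b → + 0 - −1^ a * + (n C suc m) + b) (ℕ.+-suc n m) (trans (inverse-of-D₂ w wD≈1 n m) (Dinv-zero n m)) ⟩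
    + 0 - (- −1^ (n ℕ.+ m)) * + (n C suc m) + −1^ (n ℕ.+ m) * + (n C m)
      ≡⟨ solve 3 (λ s a b → con (+ 0) :- (:- s) :* b :+ s :* a := (:- (:- s)) :* (a :+ b)) refl (−1^ (n ℕ.+ m)) (+ (n C m)) (+ (n C suc m)) ⟩
    (- (- −1^ (n ℕ.+ m))) * (+ (n C m) + + (n C suc m))
      ≡⟨ cong₂ _*_ (cong -_ (cong −1^ (sym (ℕ.+-suc n m)))) (trans (sym (ℤ.pos-+ (n C m) (n C suc m))) (cong +_ (sym (pascal n m)))) ⟩
    −1^ (suc n ℕ.+ suc m) * + (suc n C suc m)
      ≡⟨ sym (Dinv-zero (suc n) (suc m)) ⟩
    Dinv 0 (suc n) (suc m) ∎
    where open ≡-Reasoning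


module Composition where

  open import Data.Nat as ℕ using (zero; suc; _≤_; _<_; _∸_)
  import Data.Nat.Properties as ℕ
  open import Data.Integer as ℤ using (+_; _*_)
  import Data.Integer.Properties as ℤ
  open import Relation.Binary.PropositionalEquality
  open import Defs
  open Sums
  open Series
  open InverseOfD
  open import Algebra.Properties.CommutativeSemigroup ℤ.*-commutativeSemigroup using (x∙yz≈y∙xz)

  -- the coefficients Σ_j F_j [x^(n-j) y^m] (1 + x - xy)^-(2j+1) of w F(x w²) for w = 1/(1 + x - xy)
  composite : Series1 → Series2
  composite F n m = sumTo n (λ j → F j * Dinv (2 ℕ.* j) (n ∸ j) m)

  module _ (w : Series2) (wD≈1 : (w *₂ D₂) ≈₂ one₂) where

    private
      w≈Dinv : w ≈₂ Dinv 0
      w≈Dinv = inverse-of-D₂ w wD≈1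

      u : Series2
      u = X₂ *₂ (w *₂ w)

      Dinv-index : ∀ {a b} → a ≡ b → Dinv a ≈₂ Dinv b
      Dinv-index refl n m = refl

      u≈ : u ≈₂ shiftX 1 (Dinv 1)
      u≈ = ≈₂-trans (*₂-cong X₂≈shiftX-one₂ (*₂-cong w≈Dinv w≈Dinv))
           (≈₂-trans (*₂-shiftXˡ 1 one₂ (Dinv 0 *₂ Dinv 0))
                     (shiftX-cong 1 (≈₂-trans (*₂-identityˡ (Dinv 0 *₂ Dinv 0)) (Dinv-*₂ 0 0))))

      u^suc≈ : ∀ j → pow₂ u (suc j) ≈₂ shiftX (suc j) (Dinv (suc (2 ℕ.* j)))
      u^suc≈ zero = ≈₂-trans (*₂-identityʳ u) u≈
      u^suc≈ (suc j) =
        ≈₂-trans (*₂-cong u≈ (u^suc≈ j))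
        (≈₂-trans (*₂-shiftXˡ 1 (Dinv 1) (shiftX (suc j) (Dinv (suc (2 ℕ.* j)))))
        (≈₂-trans (shiftX-cong 1 (*₂-shiftXʳ (suc j) (Dinv 1) (Dinv (suc (2 ℕ.* j)))))
        (≈₂-trans (shiftX-cong 1 (shiftX-cong (suc j) (≈₂-trans (Dinv-*₂ 1 (suc (2 ℕ.* j)))
                                                                 (Dinv-index (cong suc (sym (ℕ.*-suc 2 j)))))))
                  (shiftX-shiftX 1 (suc j) (Dinv (suc (2 ℕ.* suc j)))))))

      u^-< : ∀ j a b → a < j → pow₂ u j a b ≡ + 0
      u^-< (suc j) a b a<j = trans (u^suc≈ j a b) (shiftX-< (suc j) _ a b a<j)

    w*u^≈ : ∀ j → (w *₂ pow₂ u j) ≈₂ shiftX j (Dinv (2 ℕ.* j))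
    w*u^≈ zero = ≈₂-trans (*₂-identityʳ w) w≈Dinv
    w*u^≈ (suc j) =
      ≈₂-trans (*₂-cong w≈Dinv (u^suc≈ j))
      (≈₂-trans (*₂-shiftXʳ (suc j) (Dinv 0) (Dinv (suc (2 ℕ.* j))))
                (shiftX-cong (suc j) (≈₂-trans (Dinv-*₂ 0 (suc (2 ℕ.* j))) (Dinv-index (sym (ℕ.*-suc 2 j))))))

    *₂-compose≈composite : ∀ F → (w *₂ compose F (X₂ *₂ (w *₂ w))) ≈₂ composite F
    *₂-compose≈composite F n m = begin
      sumTo n (λ i → sumTo m (λ l → w i l * sumTo (n ∸ i) (λ j → F j * pow₂ u j (n ∸ i) (m ∸ l))))
        ≡⟨ sumTo-cong n _ _ (λ i _ → sumTo-cong m _ _ (λ l _ → cong (w i l *_) (sym (sumTo-truncate n (n ∸ i) _ (ℕ.m∸n≤m n i)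
              (λ j n∸i<j _ → trans (cong (F j *_) (u^-< j (n ∸ i) (m ∸ l) n∸i<j)) (ℤ.*-zeroʳ (F j))))))) ⟩
      sumTo n (λ i → sumTo m (λ l → w i l * sumTo n (λ j → F j * pow₂ u j (n ∸ i) (m ∸ l))))
        ≡⟨ sumTo-cong n _ _ (λ i _ → trans (sumTo-cong m _ _ (λ l _ → sumTo-*ˡ n (w i l) _))
                                           (sumTo-comm m n (λ l j → w i l * (F j * pow₂ u j (n ∸ i) (m ∸ l))))) ⟩
      sumTo n (λ i → sumTo n (λ j → sumTo m (λ l → w i l * (F j * pow₂ u j (n ∸ i) (m ∸ l)))))
        ≡⟨ sumTo-comm n n (λ i j → sumTo m (λ l → w i l * (F j * pow₂ u j (n ∸ i) (m ∸ l)))) ⟩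
      sumTo n (λ j → sumTo n (λ i → sumTo m (λ l → w i l * (F j * pow₂ u j (n ∸ i) (m ∸ l)))))
        ≡⟨ sumTo-cong n _ _ (λ j j≤n → trans (sumTo-cong n _ _ (λ i _ → trans (sumTo-cong m _ _ (λ l _ → x∙yz≈y∙xz (w i l) (F j) _))
                                                                           (sym (sumTo-*ˡ m (F j) (λ l → w i l * pow₂ u j (n ∸ i) (m ∸ l))))))
                                               (trans (sym (sumTo-*ˡ n (F j) _)) (cong (F j *_) (trans (w*u^≈ j n m) (shifted j j≤n))))) ⟩
      sumTo n (λ j → F j * Dinv (2 ℕ.* j) (n ∸ j) m) ∎
      where
      open ≡-Reasoning
      shifted : ∀ j → j ≤ n → shiftX j (Dinv (2 ℕ.* j)) n m ≡ Dinv (2 ℕ.* j) (n ∸ j) m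
      shifted j j≤n = trans (cong (λ z → shiftX j (Dinv (2 ℕ.* j)) z m) (sym (ℕ.m+[n∸m]≡n j≤n))) (shiftX-+ j _ (n ∸ j) m)


module CompositeCoefficients where

  open import Data.Nat as ℕ using (zero; suc; _≤_; _<_; z≤n; _∸_)
  import Data.Nat.Properties as ℕ
  open import Data.Nat.Combinatorics using (_C_; k>n⇒nCk≡0)
  open import Data.Integer as ℤ using (ℤ; +_; -_; _+_; _*_; _-_)
  import Data.Integer.Properties as ℤ
  open import Relation.Binary.PropositionalEquality using (_≡_; refl; sym; trans; cong; cong₂; module ≡-Reasoning)
  open import Data.Empty using (⊥-elim)
  open import Data.Integer.Solver using (module +-*-Solver)
  open +-*-Solver
  open import Defs
  open Sums
  open InverseOfD
  open Composition
  open import Algebra.Properties.CommutativeSemigroup ℤ.*-commutativeSemigroup using (x∙yz≈y∙xz)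

  private
    +-suc : ∀ a → + suc a ≡ + a + + 1
    +-suc a = trans (cong +_ (ℕ.+-comm 1 a)) (ℤ.pos-+ a 1)

    −1^-suc-suc : ∀ r m → −1^ (suc r ℕ.+ suc m) ≡ −1^ (r ℕ.+ m)
    −1^-suc-suc r m = trans (cong (λ z → - −1^ z) (ℕ.+-suc r m)) (ℤ.neg-involutive (−1^ (r ℕ.+ m)))

    -- With A₁, C₂ and C₁ eliminated by the three hypotheses both sides agree, so the difference
    -- is a combination of the hypotheses.
    recurrence-from-absorption : ∀ s A₀ A₁ C₀ C₁ C₂ M R J →
      (M + + 1) * C₂ ≡ (R + + 1) * C₀ → C₂ ≡ C₀ + C₁ → (R + + 1) * A₁ ≡ (+ 2 * J + R + + 1) * A₀ →
      (M + + 1) * (s * (A₁ * C₂)) ≡ (M + + 1) * ((- s) * (A₀ * C₁)) + (+ 2 * (J + R) + + 1 - M) * (s * (A₀ * C₀))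
    recurrence-from-absorption s A₀ A₁ C₀ C₁ C₂ M R J e₁ e₂ e₃ =
      trans (solve 9 (λ s A₀ A₁ C₀ C₁ C₂ M R J →
         (M :+ con (+ 1)) :* (s :* (A₁ :* C₂)) :=
         ((M :+ con (+ 1)) :* ((:- s) :* (A₀ :* C₁)) :+ (con (+ 2) :* (J :+ R) :+ con (+ 1) :- M) :* (s :* (A₀ :* C₀)))
         :+ (s :* A₁ :* ((M :+ con (+ 1)) :* C₂ :- (R :+ con (+ 1)) :* C₀)
             :+ s :* C₀ :* ((R :+ con (+ 1)) :* A₁ :- (con (+ 2) :* J :+ R :+ con (+ 1)) :* A₀)
             :- (M :+ con (+ 1)) :* s :* A₀ :* (C₂ :- (C₀ :+ C₁)) :+ s :* A₀ :* ((M :+ con (+ 1)) :* C₂ :- (R :+ con (+ 1)) :* C₀)))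
         refl s A₀ A₁ C₀ C₁ C₂ M R J)
      (trans (cong (λ z → RHS + z) difference≡0) (ℤ.+-identityʳ RHS))
      where
      RHS = (M + + 1) * ((- s) * (A₀ * C₁)) + (+ 2 * (J + R) + + 1 - M) * (s * (A₀ * C₀))
      ≡⇒-≡0 : ∀ {a b : ℤ} → a ≡ b → a - b ≡ + 0
      ≡⇒-≡0 {a} refl = ℤ.+-inverseʳ a
      difference≡0 : s * A₁ * ((M + + 1) * C₂ - (R + + 1) * C₀) + s * C₀ * ((R + + 1) * A₁ - (+ 2 * J + R + + 1) * A₀)
                     - (M + + 1) * s * A₀ * (C₂ - (C₀ + C₁)) + s * A₀ * ((M + + 1) * C₂ - (R + + 1) * C₀) ≡ + 0
      difference≡0 rewrite ≡⇒-≡0 e₁ | ≡⇒-≡0 e₂ | ≡⇒-≡0 e₃ =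
        solve 4 (λ a b c d → a :* con (+ 0) :+ b :* con (+ 0) :- c :* con (+ 0) :+ d :* con (+ 0) := con (+ 0))
          refl (s * A₁) (s * C₀) ((M + + 1) * s * A₀) (s * A₀)

  Dinv-even-recurrence : ∀ j r m → + (suc m) * Dinv (2 ℕ.* j) (suc r) (suc m) ≡
     + (suc m) * Dinv (2 ℕ.* j) r (suc m) + (+ (2 ℕ.* (j ℕ.+ r) ℕ.+ 1) - + m) * Dinv (2 ℕ.* j) r m
  Dinv-even-recurrence j r m = begin
    + (suc m) * (−1^ (suc r ℕ.+ suc m) * + (multichoose s (suc r) ℕ.* (suc r C suc m)))
      ≡⟨ cong₂ (λ a b → a * (b * + (multichoose s (suc r) ℕ.* (suc r C suc m)))) (+-suc m) (−1^-suc-suc r m) ⟩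
    (M + + 1) * (σ * + (multichoose s (suc r) ℕ.* (suc r C suc m)))
      ≡⟨ cong (λ z → (M + + 1) * (σ * z)) (ℤ.pos-* (multichoose s (suc r)) (suc r C suc m)) ⟩
    (M + + 1) * (σ * (A₁ * C₂))
      ≡⟨ recurrence-from-absorption σ A₀ A₁ C₀ C₁ C₂ M R J e₁ e₂ e₃ ⟩
    (M + + 1) * ((- σ) * (A₀ * C₁)) + (+ 2 * (J + R) + + 1 - M) * (σ * (A₀ * C₀))
      ≡⟨ sym (cong₂ _+_ (cong₂ _*_ (+-suc m) (cong₂ _*_ (cong −1^ (ℕ.+-suc r m)) (ℤ.pos-* (multichoose s r) (r C suc m))))
                        (cong₂ _*_ (cong (_- + m) two-j+r+1) (cong (σ *_) (ℤ.pos-* (multichoose s r) (r C m))))) ⟩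
    + (suc m) * Dinv s r (suc m) + (+ (2 ℕ.* (j ℕ.+ r) ℕ.+ 1) - + m) * Dinv s r m ∎
    where
    open ≡-Reasoning
    s = 2 ℕ.* j
    σ = −1^ (r ℕ.+ m)
    M = + m
    R = + r
    J = + j
    A₀ = + multichoose s r
    A₁ = + multichoose s (suc r)
    C₀ = + (r C m)
    C₁ = + (r C suc m)
    C₂ = + (suc r C suc m)
    e₁ : (M + + 1) * C₂ ≡ (R + + 1) * C₀
    e₁ = trans (cong (_* C₂) (sym (+-suc m)))
         (trans (sym (ℤ.pos-* (suc m) _)) (trans (cong +_ (absorption r m)) (trans (ℤ.pos-* (suc r) _) (cong (_* C₀) (+-suc r)))))
    e₂ : C₂ ≡ C₀ + C₁
    e₂ = trans (cong +_ (pascal r m)) (ℤ.pos-+ (r C m) (r C suc m))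
    e₃ : (R + + 1) * A₁ ≡ (+ 2 * J + R + + 1) * A₀
    e₃ = trans (cong (_* A₁) (sym (+-suc r)))
         (trans (sym (ℤ.pos-* (suc r) _))
         (trans (cong +_ (trans (cong (λ z → suc r ℕ.* (z C suc r)) (ℕ.+-suc s r)) (absorption (s ℕ.+ r) r)))
         (trans (ℤ.pos-* (suc (s ℕ.+ r)) _)
                (cong (_* A₀) (trans (+-suc (s ℕ.+ r)) (cong (_+ + 1) (trans (ℤ.pos-+ s r) (cong (_+ R) (ℤ.pos-* 2 j)))))))))
    two-j+r+1 : + (2 ℕ.* (j ℕ.+ r) ℕ.+ 1) ≡ + 2 * (J + R) + + 1
    two-j+r+1 = trans (ℤ.pos-+ (2 ℕ.* (j ℕ.+ r)) 1) (cong (_+ + 1) (trans (ℤ.pos-* 2 (j ℕ.+ r)) (cong (+ 2 *_) (ℤ.pos-+ j r))))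

  composite-recurrence : ∀ F n m → + (suc m) * composite F (suc n) (suc m)
    ≡ + (suc m) * composite F n (suc m) + (+ (2 ℕ.* n ℕ.+ 1) - + m) * composite F n m
  composite-recurrence F n m = begin
    + (suc m) * (sumTo n (λ j → F j * Dinv (2 ℕ.* j) (suc n ∸ j) (suc m)) + F (suc n) * Dinv (2 ℕ.* suc n) (n ∸ n) (suc m))
      ≡⟨ cong (λ z → + (suc m) * (sumTo n (λ j → F j * Dinv (2 ℕ.* j) (suc n ∸ j) (suc m)) + z)) newest≡0 ⟩
    + (suc m) * (sumTo n (λ j → F j * Dinv (2 ℕ.* j) (suc n ∸ j) (suc m)) + + 0)
      ≡⟨ cong (+ (suc m) *_) (ℤ.+-identityʳ _) ⟩
    + (suc m) * sumTo n (λ j → F j * Dinv (2 ℕ.* j) (suc n ∸ j) (suc m))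
      ≡⟨ sumTo-*ˡ n (+ (suc m)) _ ⟩
    sumTo n (λ j → + (suc m) * (F j * Dinv (2 ℕ.* j) (suc n ∸ j) (suc m)))
      ≡⟨ sumTo-cong n _ _ termwise ⟩
    sumTo n (λ j → + (suc m) * (F j * Dinv (2 ℕ.* j) (n ∸ j) (suc m)) + c * (F j * Dinv (2 ℕ.* j) (n ∸ j) m))
      ≡⟨ sumTo-distrib n _ _ ⟩
    sumTo n (λ j → + (suc m) * (F j * Dinv (2 ℕ.* j) (n ∸ j) (suc m))) + sumTo n (λ j → c * (F j * Dinv (2 ℕ.* j) (n ∸ j) m))
      ≡⟨ sym (cong₂ _+_ (sumTo-*ˡ n (+ (suc m)) _) (sumTo-*ˡ n c _)) ⟩
    + (suc m) * composite F n (suc m) + c * composite F n m ∎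
    where
    open ≡-Reasoning
    c = + (2 ℕ.* n ℕ.+ 1) - + m
    newest≡0 : F (suc n) * Dinv (2 ℕ.* suc n) (n ∸ n) (suc m) ≡ + 0
    newest≡0 = trans (cong (λ z → F (suc n) * Dinv (2 ℕ.* suc n) z (suc m)) (ℕ.n∸n≡0 n))
                     (trans (cong (F (suc n) *_) (ℤ.*-zeroʳ (−1^ (suc m)))) (ℤ.*-zeroʳ (F (suc n))))
    termwise : ∀ j → j ≤ n → + (suc m) * (F j * Dinv (2 ℕ.* j) (suc n ∸ j) (suc m))
                           ≡ + (suc m) * (F j * Dinv (2 ℕ.* j) (n ∸ j) (suc m)) + c * (F j * Dinv (2 ℕ.* j) (n ∸ j) m)
    termwise j j≤n = begin
      + (suc m) * (F j * Dinv (2 ℕ.* j) (suc n ∸ j) (suc m))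
        ≡⟨ cong (λ z → + (suc m) * (F j * Dinv (2 ℕ.* j) z (suc m))) (ℕ.+-∸-assoc 1 j≤n) ⟩
      + (suc m) * (F j * Dinv (2 ℕ.* j) (suc (n ∸ j)) (suc m))
        ≡⟨ x∙yz≈y∙xz (+ (suc m)) (F j) _ ⟩
      F j * (+ (suc m) * Dinv (2 ℕ.* j) (suc (n ∸ j)) (suc m))
        ≡⟨ cong (F j *_) (trans (Dinv-even-recurrence j (n ∸ j) m)
             (cong (λ z → + (suc m) * Dinv (2 ℕ.* j) (n ∸ j) (suc m) + (+ (2 ℕ.* z ℕ.+ 1) - + m) * Dinv (2 ℕ.* j) (n ∸ j) m)
                   (ℕ.m+[n∸m]≡n j≤n))) ⟩
      F j * (+ (suc m) * Dinv (2 ℕ.* j) (n ∸ j) (suc m) + c * Dinv (2 ℕ.* j) (n ∸ j) m)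
        ≡⟨ solve 5 (λ f a b x y → f :* (a :* x :+ b :* y) := a :* (f :* x) :+ b :* (f :* y)) refl
             (F j) (+ (suc m)) c (Dinv (2 ℕ.* j) (n ∸ j) (suc m)) (Dinv (2 ℕ.* j) (n ∸ j) m) ⟩
      + (suc m) * (F j * Dinv (2 ℕ.* j) (n ∸ j) (suc m)) + c * (F j * Dinv (2 ℕ.* j) (n ∸ j) m) ∎

  composite-zero-suc : ∀ F m → composite F 0 (suc m) ≡ + 0
  composite-zero-suc F m = trans (cong (F 0 *_) (ℤ.*-zeroʳ (−1^ (suc m)))) (ℤ.*-zeroʳ (F 0))

  private
    alternating-sum : ∀ r K → sumTo K (λ m → −1^ m * + (suc r C m)) ≡ −1^ K * + (r C K)
    alternating-sum r zero = refl
    alternating-sum r (suc K) = begin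
      sumTo K (λ m → −1^ m * + (suc r C m)) + (- −1^ K) * + (suc r C suc K)
        ≡⟨ cong₂ _+_ (alternating-sum r K) (cong ((- −1^ K) *_) (trans (cong +_ (pascal r K)) (ℤ.pos-+ (r C K) (r C suc K)))) ⟩
      −1^ K * + (r C K) + (- −1^ K) * (+ (r C K) + + (r C suc K))
        ≡⟨ solve 3 (λ s a b → s :* a :+ (:- s) :* (a :+ b) := (:- s) :* b) refl (−1^ K) (+ (r C K)) (+ (r C suc K)) ⟩
      (- −1^ K) * + (r C suc K) ∎
      where open ≡-Reasoning

    rowSum-Dinv-zero : ∀ s K → sumTo K (λ m → Dinv s 0 m) ≡ + 1
    rowSum-Dinv-zero s K = sumTo-truncate K 0 _ z≤n (λ { (suc i) _ _ → ℤ.*-zeroʳ (−1^ (suc i)) })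

    -- at y = 1 the series (1 + x - xy)^-(s+1) is 1, so its x^(r+1) part sums to 0
    rowSum-Dinv-suc : ∀ s r K → suc r ≤ K → sumTo K (λ m → Dinv s (suc r) m) ≡ + 0
    rowSum-Dinv-suc s r K r<K = begin
      sumTo K (λ m → Dinv s (suc r) m)
        ≡⟨ sumTo-cong K _ _ (λ m _ → separate m) ⟩
      sumTo K (λ m → a * (−1^ m * + (suc r C m)))
        ≡⟨ sym (sumTo-*ˡ K a (λ m → −1^ m * + (suc r C m))) ⟩
      a * sumTo K (λ m → −1^ m * + (suc r C m))
        ≡⟨ cong (a *_) (trans (alternating-sum r K) (cong (λ z → −1^ K * + z) (k>n⇒nCk≡0 r<K))) ⟩
      a * (−1^ K * + 0)
        ≡⟨ trans (cong (a *_) (ℤ.*-zeroʳ (−1^ K))) (ℤ.*-zeroʳ a) ⟩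
      + 0 ∎
      where
      open ≡-Reasoning
      a = −1^ (suc r) * + multichoose s (suc r)
      separate : ∀ m → Dinv s (suc r) m ≡ a * (−1^ m * + (suc r C m))
      separate m = trans (cong₂ _*_ (−1^-+ (suc r) m) (ℤ.pos-* (multichoose s (suc r)) (suc r C m)))
        (solve 4 (λ a b c d → (a :* b) :* (c :* d) := (a :* c) :* (b :* d)) refl
          (−1^ (suc r)) (−1^ m) (+ multichoose s (suc r)) (+ (suc r C m)))

  composite-rowSum : ∀ F n → sumTo (2 ℕ.* n) (λ m → composite F n m) ≡ F n
  composite-rowSum F n = begin
    sumTo K (λ m → sumTo n (λ j → F j * Dinv (2 ℕ.* j) (n ∸ j) m))
      ≡⟨ sumTo-comm K n (λ m j → F j * Dinv (2 ℕ.* j) (n ∸ j) m) ⟩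
    sumTo n (λ j → sumTo K (λ m → F j * Dinv (2 ℕ.* j) (n ∸ j) m))
      ≡⟨ sumTo-cong n _ _ (λ j _ → sym (sumTo-*ˡ K (F j) (λ m → Dinv (2 ℕ.* j) (n ∸ j) m))) ⟩
    sumTo n (λ j → F j * sumTo K (λ m → Dinv (2 ℕ.* j) (n ∸ j) m))
      ≡⟨ sumTo-last n _ earlier≡0 ⟩
    F n * sumTo K (λ m → Dinv (2 ℕ.* n) (n ∸ n) m)
      ≡⟨ cong (λ z → F n * sumTo K (λ m → Dinv (2 ℕ.* n) z m)) (ℕ.n∸n≡0 n) ⟩
    F n * sumTo K (λ m → Dinv (2 ℕ.* n) 0 m)
      ≡⟨ cong (F n *_) (rowSum-Dinv-zero (2 ℕ.* n) K) ⟩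
    F n * + 1
      ≡⟨ ℤ.*-identityʳ (F n) ⟩
    F n ∎
    where
    open ≡-Reasoning
    K = 2 ℕ.* n
    earlier≡0 : ∀ j → j < n → F j * sumTo K (λ m → Dinv (2 ℕ.* j) (n ∸ j) m) ≡ + 0
    earlier≡0 j j<n with n ∸ j | ℕ.m>n⇒m∸n≢0 j<n | ℕ.m∸n≤m n j
    ... | zero | n∸j≢0 | _ = ⊥-elim (n∸j≢0 refl)
    ... | suc r | _ | n∸j≤n =
      trans (cong (F j *_) (rowSum-Dinv-suc (2 ℕ.* j) r K (ℕ.≤-trans n∸j≤n (ℕ.m≤m+n n (n ℕ.+ 0))))) (ℤ.*-zeroʳ (F j))


module RowSums where

  open import Data.Nat as ℕ using (ℕ; zero; suc; _≤_; s≤s; z≤n; _≟_)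
  import Data.Nat.Properties as ℕ
  open import Data.Integer using (+_)
  open import Data.List using ([]; _∷_)
  open import Data.Vec using (lookup)
  open import Relation.Nullary.Decidable using (_×-dec_; ¬?)
  open import Relation.Unary using (Decidable)
  open import Relation.Binary.PropositionalEquality
  open import Data.Sum using (inj₁; inj₂)
  open import Defs
  open Counting
  open Encoding using (numOneArcs-≤)
  open Sums

  sumToℕ-𝟙-≟ : ∀ a K → a ≤ K → sumToℕ K (λ m → 𝟙 (a ≟ m)) ≡ 1
  sumToℕ-𝟙-≟ zero zero z≤n = refl
  sumToℕ-𝟙-≟ a (suc K) a≤K+1 with ℕ.m≤n⇒m<n∨m≡n a≤K+1
  ... | inj₁ (s≤s a≤K) = trans (cong₂ ℕ._+_ (sumToℕ-𝟙-≟ a K a≤K) (𝟙-no (a ≟ suc K) (λ { refl → ℕ.<-irrefl refl (s≤s a≤K) })))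
                               (ℕ.+-identityʳ 1)
  ... | inj₂ refl = cong₂ ℕ._+_ (sumToℕ-zero K _ (λ m m≤K → 𝟙-no (suc K ≟ m) (λ { refl → ℕ.<-irrefl refl (s≤s m≤K) })))
                                (𝟙-yes (suc K ≟ suc K) refl)

  sumToℕ-count-by-value : ∀ {X : Set} {A B : X → Set} (A? : Decidable A) (B? : Decidable B) (o : X → ℕ) K xs →
    (∀ x → o x ≤ K) → sumToℕ K (λ m → count (λ x → A? x ×-dec (B? x ×-dec (o x ≟ m))) xs) ≡ count (λ x → A? x ×-dec B? x) xs
  sumToℕ-count-by-value A? B? o K [] _ = sumToℕ-zero K _ (λ _ _ → refl)
  sumToℕ-count-by-value A? B? o K (x ∷ xs) o≤K = begin
    sumToℕ K (λ m → count (P? m) (x ∷ xs))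
      ≡⟨ sumToℕ-cong K _ _ (λ m _ → count-∷ (P? m) x xs) ⟩
    sumToℕ K (λ m → 𝟙 (P? m x) ℕ.+ count (P? m) xs)
      ≡⟨ sumToℕ-distrib K _ _ ⟩
    sumToℕ K (λ m → 𝟙 (P? m x)) ℕ.+ sumToℕ K (λ m → count (P? m) xs)
      ≡⟨ cong₂ ℕ._+_ head (sumToℕ-count-by-value A? B? o K xs o≤K) ⟩
    𝟙 (A? x ×-dec B? x) ℕ.+ count (λ x → A? x ×-dec B? x) xs
      ≡⟨ sym (count-∷ (λ x → A? x ×-dec B? x) x xs) ⟩
    count (λ x → A? x ×-dec B? x) (x ∷ xs) ∎
    where
    open ≡-Reasoning
    P? = λ m x → A? x ×-dec (B? x ×-dec (o x ≟ m))
    head : sumToℕ K (λ m → 𝟙 (P? m x)) ≡ 𝟙 (A? x ×-dec B? x)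
    head = begin
      sumToℕ K (λ m → 𝟙 (P? m x))
        ≡⟨ sumToℕ-cong K _ _ (λ m _ → trans (sym (𝟙-× (A? x) (B? x ×-dec (o x ≟ m)) (P? m x)))
                                      (trans (cong (𝟙 (A? x) ℕ.*_) (sym (𝟙-× (B? x) (o x ≟ m) _)))
                                             (trans (sym (ℕ.*-assoc (𝟙 (A? x)) _ _))
                                                    (cong (ℕ._* 𝟙 (o x ≟ m)) (𝟙-× (A? x) (B? x) (A? x ×-dec B? x)))))) ⟩
      sumToℕ K (λ m → 𝟙 (A? x ×-dec B? x) ℕ.* 𝟙 (o x ≟ m))
        ≡⟨ sym (sumToℕ-*ˡ K (𝟙 (A? x ×-dec B? x)) _) ⟩
      𝟙 (A? x ×-dec B? x) ℕ.* sumToℕ K (λ m → 𝟙 (o x ≟ m))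
        ≡⟨ cong (𝟙 (A? x ×-dec B? x) ℕ.*_) (sumToℕ-𝟙-≟ (o x) K (o≤K x)) ⟩
      𝟙 (A? x ×-dec B? x) ℕ.* 1
        ≡⟨ ℕ.*-identityʳ _ ⟩
      𝟙 (A? x ×-dec B? x) ∎

  gk-rowSum : ∀ k n → sumTo (2 ℕ.* n) (λ m → + gk k n m) ≡ + fk k n
  gk-rowSum k n = trans (sumTo-+ N (gk k n)) (cong +_
    (sumToℕ-count-by-value (λ v → isMatching? N (lookup v)) (λ v → ¬? (hasKCrossing? N k (lookup v)))
                           (λ v → numOneArcs N (lookup v)) N (allVecs N N) numOneArcs-≤))
    where N = 2 ℕ.* n


module Uniqueness where

  open import Data.Nat as ℕ using (zero; suc)
  import Data.Nat.Properties as ℕ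
  open import Data.Integer as ℤ using (+_; _+_; _*_; _-_)
  import Data.Integer.Properties as ℤ
  open import Algebra.Properties.AbelianGroup ℤ.+-0-abelianGroup using () renaming (∙-cancelʳ to +-cancelʳ)
  open import Relation.Binary.PropositionalEquality
  open import Defs
  open Sums

  SatisfiesRecurrence : Series2 → Set
  SatisfiesRecurrence X = ∀ n m → + (suc m) * X (suc n) (suc m) ≡ + (suc m) * X n (suc m) + (+ (2 ℕ.* n ℕ.+ 1) - + m) * X n m

  recurrence-unique : ∀ X Y → SatisfiesRecurrence X → SatisfiesRecurrence Y →
    (∀ n → sumTo (2 ℕ.* n) (X n) ≡ sumTo (2 ℕ.* n) (Y n)) → (∀ m → X 0 m ≡ Y 0 m) → X ≈₂ Y
  recurrence-unique X Y X-rec Y-rec rowSums first-row = X≈Y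
    where
    X≈Y : X ≈₂ Y
    X≈Y-suc : ∀ n m → X (suc n) (suc m) ≡ Y (suc n) (suc m)
    X≈Y-suc n m =
      ℤ.*-cancelˡ-≡ (+ suc m) _ _ (trans (X-rec n m)
        (trans (cong₂ (λ a b → + (suc m) * a + (+ (2 ℕ.* n ℕ.+ 1) - + m) * b) (X≈Y n (suc m)) (X≈Y n m)) (sym (Y-rec n m))))
    X≈Y zero m = first-row m
    X≈Y (suc n) (suc m) = X≈Y-suc n m
    X≈Y (suc n) zero = +-cancelʳ (sumTo K (λ i → X (suc n) (suc i))) _ _ (begin
      X (suc n) 0 + sumTo K (λ i → X (suc n) (suc i))  ≡⟨ sym (sumTo-suc K (X (suc n))) ⟩
      sumTo (suc K) (X (suc n))                         ≡⟨ cong (λ z → sumTo z (X (suc n))) (sym 2[n+1]) ⟩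
      sumTo (2 ℕ.* suc n) (X (suc n))                   ≡⟨ rowSums (suc n) ⟩
      sumTo (2 ℕ.* suc n) (Y (suc n))                   ≡⟨ cong (λ z → sumTo z (Y (suc n))) 2[n+1] ⟩
      sumTo (suc K) (Y (suc n))                         ≡⟨ sumTo-suc K (Y (suc n)) ⟩
      Y (suc n) 0 + sumTo K (λ i → Y (suc n) (suc i))  ≡⟨ cong (λ z → Y (suc n) 0 + z) (sumTo-cong K _ _ (λ i _ → sym (X≈Y-suc n i))) ⟩
      Y (suc n) 0 + sumTo K (λ i → X (suc n) (suc i))  ∎)
      where
      open ≡-Reasoning
      K = suc (2 ℕ.* n)
      2[n+1] : 2 ℕ.* suc n ≡ suc K
      2[n+1] = ℕ.*-suc 2 n


open import Defs
open import Data.Nat using (ℕ; _≤_; _+_; _*_; suc; zero; s≤s; z≤n)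
open import Data.Integer using (+_; _-_) renaming (_+_ to _+ℤ_; _*_ to _*ℤ_)
open import Data.Product using (_×_; _,_)
open import Relation.Binary.PropositionalEquality using (_≡_; trans; sym; cong)
open Recurrence using (countMatchings->)
open RecurrenceInℤ using (gk-recurrence)
open Composition using (composite; *₂-compose≈composite)
open CompositeCoefficients using (composite-recurrence; composite-rowSum; composite-zero-suc)
open RowSums using (gk-rowSum)
open Uniqueness using (recurrence-unique)

lemma1 : (k : ℕ) → 2 ≤ k →
    ((n m : ℕ) →
    + (suc m) *ℤ + gk k (suc n) (suc m)
    ≡ + (suc m) *ℤ + gk k n (suc m) +ℤ (+ (2 * n + 1) - + m) *ℤ + gk k n m)
    × ((w : Series2) → (w *₂ D₂) ≈₂ one₂ →
    Gk k ≈₂ (w *₂ compose (Fk k) (X₂ *₂ (w *₂ w))))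
lemma1 k 2≤k = gk-recurrence k 2≤k , λ w wD≈1 n m → trans (Gk≈composite n m) (sym (*₂-compose≈composite w wD≈1 (Fk k) n m))
  where
  first-row : ∀ m → Gk k 0 m ≡ composite (Fk k) 0 m
  first-row zero = trans (gk-rowSum k 0) (sym (composite-rowSum (Fk k) 0))
  first-row (suc m) = trans (cong +_ (countMatchings-> k 0 (suc m) (s≤s z≤n))) (sym (composite-zero-suc (Fk k) m))

  Gk≈composite : Gk k ≈₂ composite (Fk k)
  Gk≈composite = recurrence-unique (Gk k) (composite (Fk k)) (gk-recurrence k 2≤k) (composite-recurrence (Fk k))
                   (λ n → trans (gk-rowSum k n) (sym (composite-rowSum (Fk k) n))) first-row
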